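{- Let $V\subseteq\mathbb{N}$ with $|V|=2k-1$ for some positive integer $k$. Then the number of trees of triangles on vertex set $V$ is $(2k-3)!!^2$. Moreover, every tree of triangles on $V$ is factor critical and has exactly $3k-3$ edges.
   Context: Let $V=\{v_1<v_2<\cdots<v_n\}\subseteq\mathbb{N}$. A connected simple graph $G$ on vertex set $V$ is a tree of triangles if either $|V|=1$, or: $v_1v_2\in E(G)$; there is a unique $m\in\{3,\ldots,n\}$ with $v_1v_m\in E(G)$ and $v_2v_m\in E(G)$; and the graph obtained from $G$ by removing the edges $v_1v_2,v_1v_m,v_2v_m$ has exactly three connected components, each of which is a tree of triangles (on its own vertex set, recursively). A graph on an odd number of vertices is factor critical if deleting any single vertex (with its incident edges) leaves a graph with a perfect matching. For odd $j\ge1$, $j!!$ is the product of the odd positive integers $\le j$, and $(-1)!!=1$. -}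

module Defs where

open import Data.Nat using (ℕ; zero; suc; _+_; _*_; _≤_; _<_; _≡ᵇ_)
open import Data.Nat.Properties using (_≟_)
open import Data.Bool using (Bool; true; false; _∧_; _∨_; not; if_then_else_)
open import Data.List using (List; []; _∷_; map)
open import Data.Nat.ListAction using (sum)
open import Data.List.Membership.Propositional using (_∈_)
open import Data.List.Membership.DecPropositional _≟_ using (_∈?_)
open import Data.List.Relation.Unary.All using (All)
open import Data.List.Relation.Unary.Any using (Any)
open import Data.List.Relation.Unary.Unique.Propositional using (Unique)
open import Data.List.Relation.Unary.AllPairs using (AllPairs)
open import Data.List using (length)
open import Data.Product using (Σ; _×_; _,_; proj₁; proj₂; ∃)
open import Data.Sum using (_⊎_)
open import Function.Bundles using (_⇔_)
open import Relation.Binary.PropositionalEquality using (_≡_; _≢_)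
open import Relation.Nullary using (¬_; ⌊_⌋)

-- Vertex sets are finite subsets of ℕ, represented by lists (membership = _∈_).
-- A graph with vertices in ℕ is given by a Boolean edge relation.
EdgeRel : Set
EdgeRel = ℕ → ℕ → Bool

_~[_]_ : ℕ → EdgeRel → ℕ → Set
x ~[ E ] y = E x y ≡ true

record SimpleGraphOn (V : List ℕ) (E : EdgeRel) : Set where
  field
    symmetric  : ∀ x y → E x y ≡ E y x
    loopless   : ∀ x → E x x ≡ false
    edgesInV   : ∀ x y → x ~[ E ] y → x ∈ V × y ∈ V

data Path (E : EdgeRel) : ℕ → ℕ → Set where
  here  : ∀ {x} → Path E x x
  step  : ∀ {x y z} → x ~[ E ] y → Path E y z → Path E x z

Connected : List ℕ → EdgeRel → Set
Connected V E = ∀ x y → x ∈ V → y ∈ V → Path E x y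

IsFirst : List ℕ → ℕ → Set
IsFirst V v = v ∈ V × (∀ w → w ∈ V → v ≤ w)

IsSecond : List ℕ → ℕ → ℕ → Set
IsSecond V v1 v2 = v2 ∈ V × v2 ≢ v1 × (∀ w → w ∈ V → w ≢ v1 → v2 ≤ w)

samePair : ℕ → ℕ → ℕ → ℕ → Bool
samePair a b x y = ((x ≡ᵇ a) ∧ (y ≡ᵇ b)) ∨ ((x ≡ᵇ b) ∧ (y ≡ᵇ a))

removeTriangle : EdgeRel → ℕ → ℕ → ℕ → EdgeRel
removeTriangle E a b c x y =
  E x y ∧ not (samePair a b x y ∨ samePair a c x y ∨ samePair b c x y)

restrict : EdgeRel → List ℕ → EdgeRel
restrict E W x y = E x y ∧ ⌊ x ∈? W ⌋ ∧ ⌊ y ∈? W ⌋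

Disjoint : List ℕ → List ℕ → Set
Disjoint A B = ∀ x → x ∈ A → x ∈ B → ⊥'
  where open import Data.Empty renaming (⊥ to ⊥')

NoEdgesBetween : EdgeRel → List ℕ → List ℕ → Set
NoEdgesBetween E A B = ∀ x y → x ∈ A → y ∈ B → E x y ≡ false

NonEmpty : List ℕ → Set
NonEmpty A = ∃ λ x → x ∈ A

-- V1, V2, V3 are exactly the (vertex sets of the) connected components of
-- the graph E on V: a partition of V into three nonempty parts, each inducing
-- a connected subgraph, with no edges between distinct parts.
ThreeComponents : List ℕ → EdgeRel → List ℕ → List ℕ → List ℕ → Set
ThreeComponents V E V1 V2 V3 =
  (∀ x → (x ∈ V ⇔ (x ∈ V1 ⊎ x ∈ V2 ⊎ x ∈ V3))) ×
  NonEmpty V1 × NonEmpty V2 × NonEmpty V3 ×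
  Disjoint V1 V2 × Disjoint V1 V3 × Disjoint V2 V3 ×
  NoEdgesBetween E V1 V2 × NoEdgesBetween E V1 V3 × NoEdgesBetween E V2 V3 ×
  NoEdgesBetween E V2 V1 × NoEdgesBetween E V3 V1 × NoEdgesBetween E V3 V2 ×
  Connected V1 (restrict E V1) × Connected V2 (restrict E V2) × Connected V3 (restrict E V3)

data TreeOfTriangles : List ℕ → EdgeRel → Set where
  single :
    ∀ {V E} → SimpleGraphOn V E → Connected V E →
    (v : ℕ) → (∀ x → (x ∈ V ⇔ x ≡ v)) →
    TreeOfTriangles V E
  triangle :
    ∀ {V E} → SimpleGraphOn V E → Connected V E →
    (v1 v2 m : ℕ) → IsFirst V v1 → IsSecond V v1 v2 →
    v1 ~[ E ] v2 →
    m ∈ V → m ≢ v1 → m ≢ v2 → v1 ~[ E ] m → v2 ~[ E ] m →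
    (∀ m' → m' ∈ V → m' ≢ v1 → m' ≢ v2 → v1 ~[ E ] m' → v2 ~[ E ] m' → m' ≡ m) →
    (V1 V2 V3 : List ℕ) →
    ThreeComponents V (removeTriangle E v1 v2 m) V1 V2 V3 →
    TreeOfTriangles V1 (restrict (removeTriangle E v1 v2 m) V1) →
    TreeOfTriangles V2 (restrict (removeTriangle E v1 v2 m) V2) →
    TreeOfTriangles V3 (restrict (removeTriangle E v1 v2 m) V3) →
    TreeOfTriangles V E

SameGraph : EdgeRel → EdgeRel → Set
SameGraph E F = ∀ x y → E x y ≡ F x y

-- the number of trees of triangles on V is N: there is a duplicate-free
-- (up to SameGraph) list of N trees of triangles on V containing every one
NumberOfTreesOfTriangles : List ℕ → ℕ → Set
NumberOfTreesOfTriangles V N =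
  Σ (List EdgeRel) λ Gs →
    length Gs ≡ N ×
    All (TreeOfTriangles V) Gs ×
    AllPairs (λ E F → ¬ SameGraph E F) Gs ×
    (∀ E → TreeOfTriangles V E → Any (SameGraph E) Gs)

incidences : ℕ → List (ℕ × ℕ) → ℕ
incidences w M =
  sum (map (λ p → (if w ≡ᵇ proj₁ p then 1 else 0) + (if w ≡ᵇ proj₂ p then 1 else 0)) M)

PerfectMatchingMinus : List ℕ → EdgeRel → ℕ → List (ℕ × ℕ) → Set
PerfectMatchingMinus V E v M =
  All (λ p → proj₁ p ~[ E ] proj₂ p × proj₁ p ∈ V × proj₂ p ∈ V ×
             proj₁ p ≢ v × proj₂ p ≢ v) M ×
  (∀ w → w ∈ V → w ≢ v → incidences w M ≡ 1)

FactorCritical : List ℕ → EdgeRel → Set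
FactorCritical V E = ∀ v → v ∈ V → Σ (List (ℕ × ℕ)) (PerfectMatchingMinus V E v)

HasEdgeCount : List ℕ → EdgeRel → ℕ → Set
HasEdgeCount V E c =
  Σ (List (ℕ × ℕ)) λ L → Unique L × length L ≡ c ×
    (∀ x y → ((x , y) ∈ L ⇔ (x < y × x ∈ V × y ∈ V × x ~[ E ] y)))

-- df n = n!!  (with 0!! = 1, 1!! = 1); used as (2k-3)!! = df (2k ∸ 3),
-- which gives (-1)!! = 1 at k = 1
df : ℕ → ℕ
df zero = 1
df (suc zero) = 1
df (suc (suc n)) = suc (suc n) * df n

-- A tree of triangles on s₁ < s₂ < ⋯ is its top triangle s₁ s₂ m with trees of triangles glued
-- on the three parts hanging from s₁, s₂ and m. Conversely, gluing trees of triangles on any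
-- three parts of the other vertices (m in the third) along that triangle gives a tree of
-- triangles, and distinct choices give distinct graphs: m is the only common neighbour of s₁ and
-- s₂, and the parts are the components left after deleting the triangle's edges. Gluing adds two
-- vertices and three edges and keeps factor criticality (with v deleted, match v's part without v,
-- the other two parts without their triangle vertices, and join these two by a triangle edge).
--
-- Counting: if f is the exponential generating function of τ n, the number of trees of triangles
-- on n + 1 vertices, the decomposition reads f′ = x f³. This holds for f = (1 - x²)^(-1/2), whose
-- coefficients are τ (2j) = ((2j - 1)!!)²: the equation (1 - x²) g′ = a x g is preserved by
-- products, the a's adding up, so f³ and (x f)′ both solve it with a = 3; they have the same
-- first two coefficients, hence x f³ = x (x f)′ = f′.

module Submission where

open import Defs
open import Data.Bool using (true; false; _∧_; _∨_; not; T; if_then_else_)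
open import Data.Bool.Properties using (∨-comm; ∧-comm; ⇔→≡)
open import Data.Empty using (⊥; ⊥-elim)
open import Data.List using (List; []; _∷_; _++_; length; map; concatMap)
open import Data.List.Properties using (length-++; length-map; map-++; map-∘; ∷-injectiveʳ)
open import Data.List.Membership.Propositional using (_∈_; _∉_; find; lose)
open import Data.List.Membership.Propositional.Properties
  using (∈-++⁺ˡ; ∈-++⁺ʳ; ∈-++⁻; ∈-map⁻; ∈-map⁺; ∈-concatMap⁺; ∈-concatMap⁻)
open import Data.List.Relation.Binary.Subset.Propositional using (_⊆_)
open import Data.List.Relation.Unary.All as All using (All; []; _∷_)
import Data.List.Relation.Unary.All.Properties as All
open import Data.List.Relation.Unary.AllPairs as AllPairs using (AllPairs; []; _∷_)
import Data.List.Relation.Unary.AllPairs.Properties as AllPairs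
open import Data.List.Relation.Unary.Any using (Any; here; there)
open import Data.List.Relation.Unary.Unique.Propositional using (Unique)
import Data.List.Relation.Unary.Unique.Propositional.Properties as Unique
open import Data.Nat using (ℕ; zero; suc; _+_; _*_; _∸_; _^_; _≤_; _<_; z≤n; s≤s; _≡ᵇ_)
open import Data.Nat.ListAction using (sum)
open import Data.Nat.ListAction.Properties using (sum-++)
open import Data.Nat.Properties
  using (_≟_; <-cmp; <-trans; <-irrefl; <-asym; <⇒≤; <⇒≱; ≤-refl; ≤-trans; ≤-reflexive; m≤m+n; m≤n+m;
         suc-injective; +-comm; +-assoc; +-suc; +-identityʳ; *-comm; *-assoc; *-zeroʳ; *-distribˡ-+; *-distribʳ-+;
         *-suc; *-cancelˡ-≡; ≡ᵇ⇒≡; ≡⇒≡ᵇ)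
open import Data.List.Membership.DecPropositional _≟_ using (_∈?_)
open import Data.Nat.Solver using (module +-*-Solver)
open import Data.Product using (∃-syntax; _×_; _,_; proj₁; proj₂)
open import Data.Sum using (_⊎_; inj₁; inj₂; [_,_]′)
open import Data.Unit using (tt)
open import Function using (_∘_; case_of_)
open import Function.Bundles using (_⇔_; mk⇔; Equivalence)
open import Relation.Binary.Definitions using (DecidableEquality; tri<; tri≈; tri>)
open import Relation.Binary.PropositionalEquality
  using (_≡_; _≢_; _≗_; refl; sym; trans; cong; cong₂; subst; subst₂; module ≡-Reasoning)
open import Relation.Nullary using (¬_; yes; no; ⌊_⌋)
open +-*-Solver using (solve; _:+_; _:*_; _:^_; _:=_; con)

Sorted : List ℕ → Set
Sorted = AllPairs _<_

sorted-head : ∀ {x xs} → Sorted (x ∷ xs) → ∀ {z} → z ∈ xs → x < z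
sorted-head (x<xs ∷ _) = All.lookup x<xs

sorted-cons : ∀ {x xs} → (∀ {z} → z ∈ xs → x < z) → Sorted xs → Sorted (x ∷ xs)
sorted-cons x<xs s = All.tabulate x<xs ∷ s

head-∉-tail : ∀ {x xs} → Sorted (x ∷ xs) → x ∉ xs
head-∉-tail s x∈ = <-irrefl refl (sorted-head s x∈)

insert : ℕ → List ℕ → List ℕ
insert x [] = x ∷ []
insert x (y ∷ ys) with <-cmp x y
... | tri< _ _ _ = x ∷ y ∷ ys
... | tri≈ _ _ _ = y ∷ ys
... | tri> _ _ _ = y ∷ insert x ys

∈-insert⁻ : ∀ {z} x S → z ∈ insert x S → z ≡ x ⊎ z ∈ S
∈-insert⁻ x [] (here p) = inj₁ p
∈-insert⁻ x (y ∷ ys) p with <-cmp x y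
∈-insert⁻ x (y ∷ ys) (here q)  | tri< _ _ _ = inj₁ q
∈-insert⁻ x (y ∷ ys) (there q) | tri< _ _ _ = inj₂ q
... | tri≈ _ _ _ = inj₂ p
∈-insert⁻ x (y ∷ ys) (here q)  | tri> _ _ _ = inj₂ (here q)
∈-insert⁻ x (y ∷ ys) (there q) | tri> _ _ _ = [ inj₁ , inj₂ ∘ there ]′ (∈-insert⁻ x ys q)

∈-insert⁺ˡ : ∀ x S → x ∈ insert x S
∈-insert⁺ˡ x [] = here refl
∈-insert⁺ˡ x (y ∷ ys) with <-cmp x y
... | tri< _ _ _ = here refl
... | tri≈ _ x≡y _ = here x≡y
... | tri> _ _ _ = there (∈-insert⁺ˡ x ys)

∈-insert⁺ʳ : ∀ {z} x S → z ∈ S → z ∈ insert x S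
∈-insert⁺ʳ x (y ∷ ys) p with <-cmp x y
... | tri< _ _ _ = there p
... | tri≈ _ _ _ = p
∈-insert⁺ʳ x (y ∷ ys) (here q)  | tri> _ _ _ = here q
∈-insert⁺ʳ x (y ∷ ys) (there q) | tri> _ _ _ = there (∈-insert⁺ʳ x ys q)

insert-sorted : ∀ x S → Sorted S → Sorted (insert x S)
insert-sorted x [] _ = [] ∷ []
insert-sorted x (y ∷ ys) s with <-cmp x y
... | tri< x<y _ _ = sorted-cons (λ { (here refl) → x<y ; (there q) → <-trans x<y (sorted-head s q) }) s
... | tri≈ _ _ _ = s
... | tri> _ _ y<x = sorted-cons (λ q → [ (λ { refl → y<x }) , sorted-head s ]′ (∈-insert⁻ x ys q))
                                (insert-sorted x ys (AllPairs.tail s))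

length-insert : ∀ x S → x ∉ S → length (insert x S) ≡ suc (length S)
length-insert x [] _ = refl
length-insert x (y ∷ ys) x∉ with <-cmp x y
... | tri< _ _ _ = refl
... | tri≈ _ x≡y _ = ⊥-elim (x∉ (here x≡y))
... | tri> _ _ _ = cong suc (length-insert x ys (λ p → x∉ (there p)))

canonical : List ℕ → List ℕ
canonical [] = []
canonical (x ∷ xs) = insert x (canonical xs)

canonical-sorted : ∀ V → Sorted (canonical V)
canonical-sorted [] = []
canonical-sorted (x ∷ xs) = insert-sorted x (canonical xs) (canonical-sorted xs)

∈-canonical⁺ : ∀ V → V ⊆ canonical V
∈-canonical⁺ (x ∷ xs) (here refl) = ∈-insert⁺ˡ x (canonical xs)
∈-canonical⁺ (x ∷ xs) (there p) = ∈-insert⁺ʳ x (canonical xs) (∈-canonical⁺ xs p)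

∈-canonical⁻ : ∀ V → canonical V ⊆ V
∈-canonical⁻ (x ∷ xs) p with ∈-insert⁻ x (canonical xs) p
... | inj₁ refl = here refl
... | inj₂ q = there (∈-canonical⁻ xs q)

length-canonical : ∀ V → Unique V → length (canonical V) ≡ length V
length-canonical [] _ = refl
length-canonical (x ∷ xs) (x∉xs ∷ u) =
  trans (length-insert x (canonical xs) (λ p → All.lookup x∉xs (∈-canonical⁻ xs p) refl))
        (cong suc (length-canonical xs u))

sorted-extensionality : ∀ {S T} → Sorted S → Sorted T → S ⊆ T → T ⊆ S → S ≡ T
sorted-extensionality {[]} {[]} _ _ _ _ = refl
sorted-extensionality {[]} {_ ∷ _} _ _ _ T⊆S with T⊆S (here refl)
... | ()
sorted-extensionality {_ ∷ _} {[]} _ _ S⊆T _ with S⊆T (here refl)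
... | ()
sorted-extensionality {x ∷ xs} {y ∷ ys} sS sT S⊆T T⊆S with heads
  where
  heads : x ≡ y
  heads with S⊆T (here refl) | T⊆S (here refl)
  ... | here x≡y | _ = x≡y
  ... | there y∈ | here y≡x = sym y≡x
  ... | there x∈ys | there y∈xs = ⊥-elim (<-asym (sorted-head sT x∈ys) (sorted-head sS y∈xs))
... | refl = cong (x ∷_) (sorted-extensionality (AllPairs.tail sS) (AllPairs.tail sT) (tails sS S⊆T) (tails sT T⊆S))
  where
  tails : ∀ {zs ws} → Sorted (x ∷ zs) → x ∷ zs ⊆ x ∷ ws → zs ⊆ ws
  tails s sub z∈ with sub (there z∈)
  ... | here refl = ⊥-elim (head-∉-tail s z∈)
  ... | there w∈ = w∈

-- Exponential generating functions

-- A sequence u stands for its exponential generating function Σ u n xⁿ / n!: ∂ is the derivative,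
-- x· multiplication by x, and ⋆ the product (binomial convolution, defined through the Leibniz rule).
Seq : Set
Seq = ℕ → ℕ

∂ : Seq → Seq
∂ u n = u (suc n)

x·_ : Seq → Seq
(x· u) zero = 0
(x· u) (suc n) = suc n * u n

_⊕_ : Seq → Seq → Seq
(u ⊕ v) n = u n + v n

_·_ : ℕ → Seq → Seq
(a · u) n = a * u n

infixl 6 _⊕_
infixl 7 _⋆_
infixr 8 _·_ x·_

_⋆_ : Seq → Seq → Seq
(u ⋆ v) zero = u 0 * v 0
(u ⋆ v) (suc n) = (∂ u ⋆ v) n + (u ⋆ ∂ v) n

⋆-cong : ∀ {u u′ v v′} → u ≗ u′ → v ≗ v′ → u ⋆ v ≗ u′ ⋆ v′
⋆-cong u≗ v≗ zero = cong₂ _*_ (u≗ 0) (v≗ 0)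
⋆-cong u≗ v≗ (suc n) = cong₂ _+_ (⋆-cong (u≗ ∘ suc) v≗ n) (⋆-cong u≗ (v≗ ∘ suc) n)

⋆-comm : ∀ u v → u ⋆ v ≗ v ⋆ u
⋆-comm u v zero = *-comm (u 0) (v 0)
⋆-comm u v (suc n) = trans (+-comm ((∂ u ⋆ v) n) _) (cong₂ _+_ (⋆-comm u (∂ v) n) (⋆-comm (∂ u) v n))

⋆-distribʳ-⊕ : ∀ u u′ v → (u ⊕ u′) ⋆ v ≗ u ⋆ v ⊕ u′ ⋆ v
⋆-distribʳ-⊕ u u′ v zero = *-distribʳ-+ (v 0) (u 0) (u′ 0)
⋆-distribʳ-⊕ u u′ v (suc n) =
  trans (cong₂ _+_ (⋆-distribʳ-⊕ (∂ u) (∂ u′) v n) (⋆-distribʳ-⊕ u u′ (∂ v) n))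
        (solve 4 (λ a b c d → (a :+ b) :+ (c :+ d) := (a :+ c) :+ (b :+ d)) refl
          ((∂ u ⋆ v) n) ((∂ u′ ⋆ v) n) ((u ⋆ ∂ v) n) ((u′ ⋆ ∂ v) n))

⋆-distribˡ-⊕ : ∀ u v v′ → u ⋆ (v ⊕ v′) ≗ u ⋆ v ⊕ u ⋆ v′
⋆-distribˡ-⊕ u v v′ n =
  trans (⋆-comm u (v ⊕ v′) n) (trans (⋆-distribʳ-⊕ v v′ u n) (cong₂ _+_ (⋆-comm v u n) (⋆-comm v′ u n)))

·-⋆ : ∀ a u v → (a · u) ⋆ v ≗ a · (u ⋆ v)
·-⋆ a u v zero = *-assoc a (u 0) (v 0)
·-⋆ a u v (suc n) =
  trans (cong₂ _+_ (·-⋆ a (∂ u) v n) (·-⋆ a u (∂ v) n)) (sym (*-distribˡ-+ a _ _))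

x·-⊕ : ∀ u v → x· (u ⊕ v) ≗ x· u ⊕ x· v
x·-⊕ u v zero = refl
x·-⊕ u v (suc n) = *-distribˡ-+ (suc n) (u n) (v n)

x·-cong : ∀ {u v} → u ≗ v → x· u ≗ x· v
x·-cong u≗v zero = refl
x·-cong u≗v (suc n) = cong (suc n *_) (u≗v n)

∂-x· : ∀ u → ∂ (x· u) ≗ u ⊕ x· ∂ u
∂-x· u zero = refl
∂-x· u (suc n) = refl

x·-∂ : ∀ u n → (x· ∂ u) n ≡ n * u n
x·-∂ u zero = refl
x·-∂ u (suc n) = refl

x·-⋆ : ∀ u v → (x· u) ⋆ v ≗ x· (u ⋆ v)
x·-⋆ u v zero = refl
x·-⋆ u v (suc n) = begin
    (∂ (x· u) ⋆ v) n + (x· u ⋆ ∂ v) n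
  ≡⟨ cong₂ _+_ (trans (⋆-cong (∂-x· u) (λ _ → refl) n) (⋆-distribʳ-⊕ u (x· ∂ u) v n)) (x·-⋆ u (∂ v) n) ⟩
    ((u ⋆ v) n + (x· ∂ u ⋆ v) n) + (x· (u ⋆ ∂ v)) n
  ≡⟨ cong (λ z → ((u ⋆ v) n + z) + (x· (u ⋆ ∂ v)) n) (x·-⋆ (∂ u) v n) ⟩
    ((u ⋆ v) n + (x· (∂ u ⋆ v)) n) + (x· (u ⋆ ∂ v)) n
  ≡⟨ +-assoc ((u ⋆ v) n) _ _ ⟩
    (u ⋆ v) n + ((x· (∂ u ⋆ v)) n + (x· (u ⋆ ∂ v)) n)
  ≡⟨ cong ((u ⋆ v) n +_) (sym (x·-⊕ (∂ u ⋆ v) (u ⋆ ∂ v) n)) ⟩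
    (u ⋆ v) n + (x· ∂ (u ⋆ v)) n
  ≡⟨ sym (∂-x· (u ⋆ v) n) ⟩
    ∂ (x· (u ⋆ v)) n
  ∎
  where open ≡-Reasoning

⋆-x· : ∀ u v → u ⋆ x· v ≗ x· (u ⋆ v)
⋆-x· u v n = trans (⋆-comm u (x· v) n) (trans (x·-⋆ v u n) (x·-cong (⋆-comm v u) n))

⋆-· : ∀ a u v → u ⋆ a · v ≗ a · (u ⋆ v)
⋆-· a u v n = trans (⋆-comm u (a · v) n) (trans (·-⋆ a v u n) (cong (a *_) (⋆-comm v u n)))

-- The egf f of u satisfies (1 - x²) f′ = a x f.
Ode : ℕ → Seq → Set
Ode a u = ∂ u ≗ a · x· u ⊕ x· x· ∂ u

⋆-ode : ∀ {a b u v} → Ode a u → Ode b v → Ode (a + b) (u ⋆ v)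
⋆-ode {a} {b} {u} {v} ode-u ode-v n = begin
    (∂ u ⋆ v) n + (u ⋆ ∂ v) n
  ≡⟨ cong₂ _+_ (⋆-cong ode-u (λ _ → refl) n) (⋆-cong (λ _ → refl) ode-v n) ⟩
    ((a · x· u ⊕ x· x· ∂ u) ⋆ v) n + (u ⋆ (b · x· v ⊕ x· x· ∂ v)) n
  ≡⟨ cong₂ _+_ (⋆-distribʳ-⊕ _ _ v n) (⋆-distribˡ-⊕ u _ _ n) ⟩
    ((a · x· u) ⋆ v) n + (x· x· ∂ u ⋆ v) n + ((u ⋆ b · x· v) n + (u ⋆ x· x· ∂ v) n)
  ≡⟨ cong₂ _+_ (cong₂ _+_ scaledˡ shiftedˡ) (cong₂ _+_ scaledʳ shiftedʳ) ⟩
    a * (x· (u ⋆ v)) n + (x· x· (∂ u ⋆ v)) n + (b * (x· (u ⋆ v)) n + (x· x· (u ⋆ ∂ v)) n)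
  ≡⟨ solve 5 (λ a b p q r → a :* p :+ q :+ (b :* p :+ r) := (a :+ b) :* p :+ (q :+ r)) refl a b _ _ _ ⟩
    (a + b) * (x· (u ⋆ v)) n + ((x· x· (∂ u ⋆ v)) n + (x· x· (u ⋆ ∂ v)) n)
  ≡⟨ cong ((a + b) * (x· (u ⋆ v)) n +_) (sym (trans (x·-cong (x·-⊕ _ _) n) (x·-⊕ _ _ n))) ⟩
    (a + b) * (x· (u ⋆ v)) n + (x· x· ∂ (u ⋆ v)) n
  ∎
  where
  open ≡-Reasoning
  scaledˡ : (a · x· u ⋆ v) n ≡ a * (x· (u ⋆ v)) n
  scaledˡ = trans (·-⋆ a (x· u) v n) (cong (a *_) (x·-⋆ u v n))
  shiftedˡ : (x· x· ∂ u ⋆ v) n ≡ (x· x· (∂ u ⋆ v)) n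
  shiftedˡ = trans (x·-⋆ (x· ∂ u) v n) (x·-cong (x·-⋆ (∂ u) v) n)
  scaledʳ : (u ⋆ b · x· v) n ≡ b * (x· (u ⋆ v)) n
  scaledʳ = trans (⋆-· b u (x· v) n) (cong (b *_) (⋆-x· u v n))
  shiftedʳ : (u ⋆ x· x· ∂ v) n ≡ (x· x· (u ⋆ ∂ v)) n
  shiftedʳ = trans (⋆-x· u (x· ∂ v) n) (x·-cong (⋆-x· u (∂ v)) n)

ode-recurrence : ∀ {a u} → Ode a u → ∀ n → u (2 + n) ≡ suc n * (a + n) * u n
ode-recurrence {a} {u} ode n = begin
    u (2 + n)
  ≡⟨ ode (suc n) ⟩
    a * (suc n * u n) + suc n * (x· ∂ u) n
  ≡⟨ cong (λ z → a * (suc n * u n) + suc n * z) (x·-∂ u n) ⟩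
    a * (suc n * u n) + suc n * (n * u n)
  ≡⟨ solve 3 (λ a n w → a :* ((con 1 :+ n) :* w) :+ (con 1 :+ n) :* (n :* w) := (con 1 :+ n) :* (a :+ n) :* w)
            refl a n (u n) ⟩
    suc n * (a + n) * u n
  ∎
  where open ≡-Reasoning

ode-one : ∀ {a u} → Ode a u → u 1 ≡ 0
ode-one {a} ode = trans (ode 0) (trans (+-identityʳ (a * 0)) (*-zeroʳ a))

-- τ n counts the trees of triangles on n + 1 vertices; its egf (1 - x²)^(-1/2) solves Ode 1.
τ : Seq
τ zero = 1
τ (suc zero) = 0
τ (suc (suc n)) = suc n * suc n * τ n

τ-ode : Ode 1 τ
τ-ode zero = refl
τ-ode (suc n) = begin
    suc n * suc n * τ n
  ≡⟨ solve 2 (λ n t → (con 1 :+ n) :* (con 1 :+ n) :* t := con 1 :* ((con 1 :+ n) :* t) :+ (con 1 :+ n) :* (n :* t))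
            refl n (τ n) ⟩
    1 * (suc n * τ n) + suc n * (n * τ n)
  ≡⟨ cong (λ z → 1 * (suc n * τ n) + suc n * z) (sym (x·-∂ τ n)) ⟩
    1 * (x· τ) (suc n) + (x· x· ∂ τ) (suc n)
  ∎
  where open ≡-Reasoning

τ³-ode : Ode 3 (τ ⋆ (τ ⋆ τ))
τ³-ode = ⋆-ode {1} {2} τ-ode (⋆-ode {1} {1} τ-ode τ-ode)

τ³ : ∀ n → (τ ⋆ (τ ⋆ τ)) n ≡ suc n * τ n
τ³ zero = refl
τ³ (suc zero) = ode-one {3} τ³-ode
τ³ (suc (suc n)) = begin
    (τ ⋆ (τ ⋆ τ)) (2 + n)
  ≡⟨ ode-recurrence {3} τ³-ode n ⟩
    suc n * (3 + n) * (τ ⋆ (τ ⋆ τ)) n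
  ≡⟨ cong (suc n * (3 + n) *_) (τ³ n) ⟩
    suc n * (3 + n) * (suc n * τ n)
  ≡⟨ solve 2 (λ n t → (con 1 :+ n) :* (con 3 :+ n) :* ((con 1 :+ n) :* t)
                   := (con 3 :+ n) :* ((con 1 :+ n) :* (con 1 :+ n) :* t)) refl n (τ n) ⟩
    (3 + n) * τ (2 + n)
  ∎
  where open ≡-Reasoning

df-suc : ∀ n → df (suc n) ≡ suc n * df (n ∸ 1)
df-suc zero = refl
df-suc (suc n) = refl

τ-even : ∀ j → τ (2 * j) ≡ df (2 * j ∸ 1) ^ 2
τ-even zero = refl
τ-even (suc j) = begin
    τ (2 * suc j)
  ≡⟨ cong τ (*-suc 2 j) ⟩
    suc (2 * j) * suc (2 * j) * τ (2 * j)
  ≡⟨ cong (suc (2 * j) * suc (2 * j) *_) (τ-even j) ⟩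
    suc (2 * j) * suc (2 * j) * df (2 * j ∸ 1) ^ 2
  ≡⟨ solve 2 (λ a d → a :* a :* (d :^ 2) := (a :* d) :^ 2) refl (suc (2 * j)) (df (2 * j ∸ 1)) ⟩
    (suc (2 * j) * df (2 * j ∸ 1)) ^ 2
  ≡⟨ cong (_^ 2) (sym (df-suc (2 * j))) ⟩
    df (suc (2 * j)) ^ 2
  ≡⟨ cong (λ n → df (n ∸ 1) ^ 2) (sym (*-suc 2 j)) ⟩
    df (2 * suc j ∸ 1) ^ 2
  ∎
  where open ≡-Reasoning

τ-suc : ∀ n → n * (τ ⋆ (τ ⋆ τ)) (n ∸ 1) ≡ τ (suc n)
τ-suc zero = refl
τ-suc (suc n) = trans (cong (suc n *_) (τ³ n)) (sym (*-assoc (suc n) (suc n) (τ n)))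

private
  variable
    A B : Set

∈-concatMap⁺′ : ∀ (f : A → List B) {xs x y} → x ∈ xs → y ∈ f x → y ∈ concatMap f xs
∈-concatMap⁺′ f x∈ y∈ = ∈-concatMap⁺ f (lose x∈ y∈)

∈-concatMap⁻′ : ∀ (f : A → List B) xs {y} → y ∈ concatMap f xs → ∃[ x ] x ∈ xs × y ∈ f x
∈-concatMap⁻′ f xs y∈ = find (∈-concatMap⁻ f {xs = xs} y∈)

AllPairs-concatMap⁺ : ∀ {S : A → A → Set} {R : B → B → Set} (f : A → List B) {xs} →
  (∀ {x} → x ∈ xs → AllPairs R (f x)) → AllPairs S xs →
  (∀ {x x′ y y′} → x ∈ xs → x′ ∈ xs → S x x′ → y ∈ f x → y′ ∈ f x′ → R y y′) →
  AllPairs R (concatMap f xs)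
AllPairs-concatMap⁺ f {[]} _ _ _ = []
AllPairs-concatMap⁺ f {x ∷ xs} inside (S-x ∷ S-xs) across =
  AllPairs.++⁺ (inside (here refl))
    (AllPairs-concatMap⁺ f (inside ∘ there) S-xs (λ x∈ x′∈ → across (there x∈) (there x′∈)))
    (All.tabulate λ y∈ → All.tabulate λ y′∈ →
      let x′ , x′∈ , y′∈′ = ∈-concatMap⁻′ f xs y′∈ in across (here refl) (there x′∈) (All.lookup S-x x′∈) y∈ y′∈′)

AllPairs-map∈ : ∀ {R S : A → A → Set} {xs} → (∀ {x y} → x ∈ xs → y ∈ xs → R x y → S x y) → AllPairs R xs → AllPairs S xs
AllPairs-map∈ f [] = []
AllPairs-map∈ f (R-x ∷ R-xs) =
  All.tabulate (λ y∈ → f (here refl) (there y∈) (All.lookup R-x y∈))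
  ∷ AllPairs-map∈ (λ x∈ y∈ → f (there x∈) (there y∈)) R-xs

sum-concatMap : ∀ (g : B → ℕ) (f : A → List B) xs →
  sum (map g (concatMap f xs)) ≡ sum (map (λ x → sum (map g (f x))) xs)
sum-concatMap g f [] = refl
sum-concatMap g f (x ∷ xs) = begin
    sum (map g (f x ++ concatMap f xs))
  ≡⟨ cong sum (map-++ g (f x) _) ⟩
    sum (map g (f x) ++ map g (concatMap f xs))
  ≡⟨ sum-++ (map g (f x)) _ ⟩
    sum (map g (f x)) + sum (map g (concatMap f xs))
  ≡⟨ cong (sum (map g (f x)) +_) (sum-concatMap g f xs) ⟩
    sum (map (λ x → sum (map g (f x))) (x ∷ xs))
  ∎
  where open ≡-Reasoning

length-concatMap : ∀ (f : A → List B) xs → length (concatMap f xs) ≡ sum (map (length ∘ f) xs)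
length-concatMap f [] = refl
length-concatMap f (x ∷ xs) = trans (length-++ (f x)) (cong (length (f x) +_) (length-concatMap f xs))

sum-map-+ : ∀ (g h : A → ℕ) xs → sum (map (λ x → g x + h x) xs) ≡ sum (map g xs) + sum (map h xs)
sum-map-+ g h [] = refl
sum-map-+ g h (x ∷ xs) = trans (cong (g x + h x +_) (sum-map-+ g h xs))
  (solve 4 (λ a b c d → (a :+ b) :+ (c :+ d) := (a :+ c) :+ (b :+ d)) refl (g x) (h x) (sum (map g xs)) (sum (map h xs)))

sum-map-const : ∀ (g : A → ℕ) c xs → (∀ {x} → x ∈ xs → g x ≡ c) → sum (map g xs) ≡ length xs * c
sum-map-const g c [] _ = refl
sum-map-const g c (x ∷ xs) g≡c = cong₂ _+_ (g≡c (here refl)) (sum-map-const g c xs (g≡c ∘ there))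

sum-map-cong : ∀ {g h : A → ℕ} xs → (∀ {x} → x ∈ xs → g x ≡ h x) → sum (map g xs) ≡ sum (map h xs)
sum-map-cong [] _ = refl
sum-map-cong (x ∷ xs) g≡h = cong₂ _+_ (g≡h (here refl)) (sum-map-cong xs (g≡h ∘ there))

-- The corners of the top triangle: its two least vertices and its apex.
data Corner : Set where
  c₁ c₂ c₃ : Corner

_≟ᶜ_ : DecidableEquality Corner
c₁ ≟ᶜ c₁ = yes refl
c₁ ≟ᶜ c₂ = no λ ()
c₁ ≟ᶜ c₃ = no λ ()
c₂ ≟ᶜ c₁ = no λ ()
c₂ ≟ᶜ c₂ = yes refl
c₂ ≟ᶜ c₃ = no λ ()
c₃ ≟ᶜ c₁ = no λ ()
c₃ ≟ᶜ c₂ = no λ ()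
c₃ ≟ᶜ c₃ = yes refl

corners : List Corner
corners = c₁ ∷ c₂ ∷ c₃ ∷ []

∈-corners : ∀ c → c ∈ corners
∈-corners c₁ = here refl
∈-corners c₂ = there (here refl)
∈-corners c₃ = there (there (here refl))

triple : A → A → A → Corner → A
triple a b c c₁ = a
triple a b c c₂ = b
triple a b c c₃ = c

choices : (Corner → List A) → List (Corner → A)
choices L = concatMap (λ a → concatMap (λ b → map (triple a b) (L c₃)) (L c₂)) (L c₁)

∈-choices⁺ : ∀ {L : Corner → List A} {e : Corner → A} → (∀ i → e i ∈ L i) →
  triple (e c₁) (e c₂) (e c₃) ∈ choices L
∈-choices⁺ {L = L} {e} e∈ =
  ∈-concatMap⁺′ (λ a → concatMap (λ b → map (triple a b) (L c₃)) (L c₂)) (e∈ c₁)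
    (∈-concatMap⁺′ (λ b → map (triple (e c₁) b) (L c₃)) (e∈ c₂) (∈-map⁺ _ (e∈ c₃)))

∈-choices⁻ : ∀ (L : Corner → List A) {E} → E ∈ choices L → ∀ i → E i ∈ L i
∈-choices⁻ L E∈ i
  with a , a∈ , E∈′ ← ∈-concatMap⁻′ (λ a → concatMap (λ b → map (triple a b) (L c₃)) (L c₂)) (L c₁) E∈
  with b , b∈ , E∈″ ← ∈-concatMap⁻′ (λ b → map (triple a b) (L c₃)) (L c₂) E∈′
  with c , c∈ , refl ← ∈-map⁻ (triple a b) E∈″
  with i
... | c₁ = a∈
... | c₂ = b∈
... | c₃ = c∈

length-choices : ∀ (L : Corner → List A) → length (choices L) ≡ length (L c₁) * (length (L c₂) * length (L c₃))
length-choices L = begin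
    length (choices L)
  ≡⟨ length-concatMap _ (L c₁) ⟩
    sum (map (λ a → length (concatMap (λ b → map (triple a b) (L c₃)) (L c₂))) (L c₁))
  ≡⟨ sum-map-const _ _ (L c₁) (λ {a} _ → begin
       length (concatMap (λ b → map (triple a b) (L c₃)) (L c₂))
     ≡⟨ length-concatMap _ (L c₂) ⟩
       sum (map (λ b → length (map (triple a b) (L c₃))) (L c₂))
     ≡⟨ sum-map-const _ _ (L c₂) (λ {b} _ → length-map (triple a b) (L c₃)) ⟩
       length (L c₂) * length (L c₃)
     ∎) ⟩
    length (L c₁) * (length (L c₂) * length (L c₃))
  ∎
  where open ≡-Reasoning

AllPairs-choices : ∀ {R : A → A → Set} {L : Corner → List A} → (∀ i → AllPairs R (L i)) →
  AllPairs (λ E F → ∃[ i ] R (E i) (F i)) (choices L)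
AllPairs-choices {R = R} {L} R-L =
  AllPairs-concatMap⁺ (λ a → concatMap (λ b → map (triple a b) (L c₃)) (L c₂))
    (λ {a} _ → AllPairs-concatMap⁺ (λ b → map (triple a b) (L c₃))
                 (λ _ → AllPairs.map⁺ (AllPairs.map (c₃ ,_) (R-L c₃)))
                 (R-L c₂)
                 (λ _ _ r y∈ y′∈ → c₂ , subst₂ R (sym (at-c₂ y∈)) (sym (at-c₂ y′∈)) r))
    (R-L c₁)
    (λ _ _ r y∈ y′∈ → c₁ , subst₂ R (sym (at-c₁ y∈)) (sym (at-c₁ y′∈)) r)
  where
  at-c₂ : ∀ {a b E} → E ∈ map (triple a b) (L c₃) → E c₂ ≡ b
  at-c₂ E∈ with _ , _ , refl ← ∈-map⁻ _ E∈ = refl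
  at-c₁ : ∀ {a E} → E ∈ concatMap (λ b → map (triple a b) (L c₃)) (L c₂) → E c₁ ≡ a
  at-c₁ {a} E∈ with b , _ , E∈′ ← ∈-concatMap⁻′ _ (L c₂) E∈ with _ , _ , refl ← ∈-map⁻ (triple a b) E∈′ = refl

picks : List ℕ → List (ℕ × List ℕ)
picks [] = []
picks (x ∷ xs) = (x , xs) ∷ map (λ p → proj₁ p , x ∷ proj₂ p) (picks xs)

record IsPick (R : List ℕ) (m : ℕ) (R′ : List ℕ) : Set where
  field
    picked∈ : m ∈ R
    picked∉ : m ∉ R′
    rest-sorted : Sorted R′
    rest⊆ : R′ ⊆ R
    ⊆rest : ∀ {z} → z ∈ R → z ≢ m → z ∈ R′
    length-rest : suc (length R′) ≡ length R

∈-picks⁻ : ∀ {R m R′} → Sorted R → (m , R′) ∈ picks R → IsPick R m R′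
∈-picks⁻ {x ∷ xs} s (here refl) = record
  { picked∈ = here refl ; picked∉ = head-∉-tail s ; rest-sorted = AllPairs.tail s ; rest⊆ = there
  ; ⊆rest = λ { (here refl) x≢x → ⊥-elim (x≢x refl) ; (there z∈) _ → z∈ }
  ; length-rest = refl }
∈-picks⁻ {x ∷ xs} s (there p∈) with (m , R′) , p∈′ , refl ← ∈-map⁻ _ p∈ = record
  { picked∈ = there picked∈
  ; picked∉ = λ { (here m≡x) → head-∉-tail s (subst (_∈ xs) m≡x picked∈) ; (there m∈) → picked∉ m∈ }
  ; rest-sorted = sorted-cons (λ z∈ → sorted-head s (rest⊆ z∈)) rest-sorted
  ; rest⊆ = λ { (here refl) → here refl ; (there z∈) → there (rest⊆ z∈) }
  ; ⊆rest = λ { (here refl) _ → here refl ; (there z∈) z≢m → there (⊆rest z∈ z≢m) }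
  ; length-rest = cong suc length-rest }
  where open IsPick (∈-picks⁻ (AllPairs.tail s) p∈′)

∈-picks⁺ : ∀ {m R} → m ∈ R → ∃[ R′ ] (m , R′) ∈ picks R
∈-picks⁺ (here refl) = _ , here refl
∈-picks⁺ {R = x ∷ xs} (there m∈) with R′ , p∈ ← ∈-picks⁺ m∈ = x ∷ R′ , there (∈-map⁺ _ p∈)

length-picks : ∀ R → length (picks R) ≡ length R
length-picks [] = refl
length-picks (x ∷ xs) = cong suc (trans (length-map _ (picks xs)) (length-picks xs))

picks-distinct : ∀ {R} → Sorted R → AllPairs (λ p q → proj₁ p ≢ proj₁ q) (picks R)
picks-distinct {[]} _ = []
picks-distinct {x ∷ xs} s =
  All.map⁺ (All.tabulate (λ {p} p∈ x≡m →
    head-∉-tail s (subst (_∈ xs) (sym x≡m) (IsPick.picked∈ (∈-picks⁻ (AllPairs.tail s) p∈)))))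
  ∷ AllPairs.map⁺ (picks-distinct (AllPairs.tail s))

Parts : Set
Parts = Corner → List ℕ

put : Corner → ℕ → Parts → Parts
put c x P i with i ≟ᶜ c
... | yes _ = x ∷ P i
... | no _ = P i

put-here : ∀ c x P → put c x P c ≡ x ∷ P c
put-here c x P with c ≟ᶜ c
... | yes _ = refl
... | no c≢c = ⊥-elim (c≢c refl)

put-elsewhere : ∀ {c i} x P → i ≢ c → put c x P i ≡ P i
put-elsewhere {c} {i} x P i≢c with i ≟ᶜ c
... | yes i≡c = ⊥-elim (i≢c i≡c)
... | no _ = refl

∈-put⁻ : ∀ c x P i {z} → z ∈ put c x P i → (i ≡ c × z ≡ x) ⊎ z ∈ P i
∈-put⁻ c x P i z∈ with i ≟ᶜ c
∈-put⁻ c x P i (here z≡x) | yes i≡c = inj₁ (i≡c , z≡x)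
∈-put⁻ c x P i (there z∈) | yes _ = inj₂ z∈
∈-put⁻ c x P i z∈ | no _ = inj₂ z∈

∈-put⁺ : ∀ c x P i {z} → z ∈ P i → z ∈ put c x P i
∈-put⁺ c x P i z∈ with i ≟ᶜ c
... | yes _ = there z∈
... | no _ = z∈

splits : List ℕ → List Parts
splits [] = (λ _ → []) ∷ []
splits (x ∷ xs) = concatMap (λ P → map (λ c → put c x P) corners) (splits xs)

record IsSplit (L : List ℕ) (P : Parts) : Set where
  field
    sorted : ∀ i → Sorted (P i)
    ⊆L : ∀ i → P i ⊆ L
    cover : ∀ {z} → z ∈ L → ∃[ i ] z ∈ P i
    disjoint : ∀ {i j z} → z ∈ P i → z ∈ P j → i ≡ j
    total-length : length (P c₁) + length (P c₂) + length (P c₃) ≡ length L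

put-isSplit : ∀ {x xs P} c → Sorted (x ∷ xs) → IsSplit xs P → IsSplit (x ∷ xs) (put c x P)
put-isSplit {x} {xs} {P} c s isSplit = record
  { sorted = sorted′
  ; ⊆L = λ i z∈ → [ (λ { (_ , refl) → here refl }) , (there ∘ ⊆L i) ]′ (∈-put⁻ c x P i z∈)
  ; cover = λ { (here refl) → c , subst (x ∈_) (sym (put-here c x P)) (here refl)
              ; (there z∈) → let i , z∈P = cover z∈ in i , ∈-put⁺ c x P i z∈P }
  ; disjoint = disjoint′
  ; total-length = total-length′ c }
  where
  open IsSplit isSplit
  x∉P : ∀ {i} → x ∉ P i
  x∉P {i} x∈ = head-∉-tail s (⊆L i x∈)
  sorted′ : ∀ i → Sorted (put c x P i)
  sorted′ i with i ≟ᶜ c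
  ... | yes _ = sorted-cons (λ z∈ → sorted-head s (⊆L i z∈)) (sorted i)
  ... | no _ = sorted i
  disjoint′ : ∀ {i j z} → z ∈ put c x P i → z ∈ put c x P j → i ≡ j
  disjoint′ {i} {j} z∈i z∈j with ∈-put⁻ c x P i z∈i | ∈-put⁻ c x P j z∈j
  ... | inj₁ (refl , _) | inj₁ (refl , _) = refl
  ... | inj₁ (_ , refl) | inj₂ x∈ = ⊥-elim (x∉P x∈)
  ... | inj₂ x∈ | inj₁ (_ , refl) = ⊥-elim (x∉P x∈)
  ... | inj₂ z∈i′ | inj₂ z∈j′ = disjoint z∈i′ z∈j′
  total-length′ : ∀ c → length (put c x P c₁) + length (put c x P c₂) + length (put c x P c₃) ≡ suc (length xs)
  total-length′ c₁ = cong suc total-length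
  total-length′ c₂ = trans (cong (_+ length (P c₃)) (+-suc (length (P c₁)) _)) (cong suc total-length)
  total-length′ c₃ = trans (+-suc (length (P c₁) + length (P c₂)) _) (cong suc total-length)

∈-splits⁻ : ∀ {L P} → Sorted L → P ∈ splits L → IsSplit L P
∈-splits⁻ {[]} _ (here refl) = record
  { sorted = λ _ → [] ; ⊆L = λ _ () ; cover = λ () ; disjoint = λ () ; total-length = refl }
∈-splits⁻ {x ∷ xs} s P∈
  with Q , Q∈ , P∈′ ← ∈-concatMap⁻′ _ (splits xs) P∈
  with c , _ , refl ← ∈-map⁻ (λ c → put c x Q) P∈′ = put-isSplit c s (∈-splits⁻ (AllPairs.tail s) Q∈)

weight : Seq → Seq → Seq → Parts → ℕ
weight u v w P = u (length (P c₁)) * (v (length (P c₂)) * w (length (P c₃)))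

splits-weight : ∀ u v w L → sum (map (weight u v w) (splits L)) ≡ (u ⋆ (v ⋆ w)) (length L)
splits-weight u v w [] = +-identityʳ _
splits-weight u v w (x ∷ xs) = begin
    sum (map (weight u v w) (concatMap (λ P → map (λ c → put c x P) corners) (splits xs)))
  ≡⟨ sum-concatMap (weight u v w) _ (splits xs) ⟩
    sum (map (λ P → weight (∂ u) v w P + (weight u (∂ v) w P + (weight u v (∂ w) P + 0))) (splits xs))
  ≡⟨ sum-map-cong (splits xs) (λ {P} _ → cong (λ z → weight (∂ u) v w P + (weight u (∂ v) w P + z)) (+-identityʳ _)) ⟩
    sum (map (λ P → weight (∂ u) v w P + (weight u (∂ v) w P + weight u v (∂ w) P)) (splits xs))
  ≡⟨ trans (sum-map-+ (weight (∂ u) v w) _ (splits xs))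
           (cong (sum (map (weight (∂ u) v w) (splits xs)) +_) (sum-map-+ (weight u (∂ v) w) _ (splits xs))) ⟩
    sum (map (weight (∂ u) v w) (splits xs))
      + (sum (map (weight u (∂ v) w) (splits xs)) + sum (map (weight u v (∂ w)) (splits xs)))
  ≡⟨ cong₂ _+_ (splits-weight (∂ u) v w xs) (cong₂ _+_ (splits-weight u (∂ v) w xs) (splits-weight u v (∂ w) xs)) ⟩
    (∂ u ⋆ (v ⋆ w)) (length xs) + ((u ⋆ (∂ v ⋆ w)) (length xs) + (u ⋆ (v ⋆ ∂ w)) (length xs))
  ≡⟨ cong ((∂ u ⋆ (v ⋆ w)) (length xs) +_) (sym (⋆-distribˡ-⊕ u (∂ v ⋆ w) (v ⋆ ∂ w) (length xs))) ⟩
    (u ⋆ (v ⋆ w)) (length (x ∷ xs))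
  ∎
  where open ≡-Reasoning

put-distinct : ∀ {x xs P Q} c d → IsSplit xs Q → x ∉ xs →
  c ≢ d ⊎ (∃[ i ] P i ≢ Q i) → ∃[ i ] put c x P i ≢ put d x Q i
put-distinct {x} {P = P} {Q} c d Q-split x∉ (inj₁ c≢d) =
  c , λ eq → x∉ (IsSplit.⊆L Q-split c
                 (subst (x ∈_) (trans (sym (put-here c x P)) (trans eq (put-elsewhere x Q c≢d))) (here refl)))
put-distinct {x} {P = P} {Q} c d Q-split x∉ (inj₂ (i , P≢Q)) with c ≟ᶜ d
... | no c≢d = put-distinct c d Q-split x∉ (inj₁ c≢d)
... | yes refl with i ≟ᶜ c
...   | yes refl = i , λ eq → P≢Q (∷-injectiveʳ (trans (sym (put-here i x P)) (trans eq (put-here i x Q))))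
...   | no i≢c = i , λ eq → P≢Q (trans (sym (put-elsewhere x P i≢c)) (trans eq (put-elsewhere x Q i≢c)))

splits-distinct : ∀ {L} → Sorted L → AllPairs (λ P Q → ∃[ i ] P i ≢ Q i) (splits L)
splits-distinct {[]} _ = [] ∷ []
splits-distinct {x ∷ xs} s =
  AllPairs-concatMap⁺ (λ P → map (λ c → put c x P) corners)
    (λ P∈ → AllPairs.map⁺ (AllPairs.map (λ c≢d → put-distinct _ _ (split P∈) x∉ (inj₁ c≢d)) corners-distinct))
    (splits-distinct (AllPairs.tail s))
    across
  where
  x∉ = head-∉-tail s
  split : ∀ {P} → P ∈ splits xs → IsSplit xs P
  split = ∈-splits⁻ (AllPairs.tail s)
  across : ∀ {P Q y y′} → P ∈ splits xs → Q ∈ splits xs → ∃[ i ] P i ≢ Q i →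
    y ∈ map (λ c → put c x P) corners → y′ ∈ map (λ c → put c x Q) corners → ∃[ i ] y i ≢ y′ i
  across {P} {Q} _ Q∈ P≢Q y∈ y′∈
    with c , _ , refl ← ∈-map⁻ (λ c → put c x P) y∈
    with d , _ , refl ← ∈-map⁻ (λ c → put c x Q) y′∈ = put-distinct c d (split Q∈) x∉ (inj₂ P≢Q)
  corners-distinct : AllPairs _≢_ corners
  corners-distinct = ((λ ()) ∷ (λ ()) ∷ []) ∷ ((λ ()) ∷ []) ∷ [] ∷ []

splitBy : (ℕ → Corner) → List ℕ → Parts
splitBy col [] _ = []
splitBy col (x ∷ xs) = put (col x) x (splitBy col xs)

splitBy∈splits : ∀ col L → splitBy col L ∈ splits L
splitBy∈splits col [] = here refl
splitBy∈splits col (x ∷ xs) =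
  ∈-concatMap⁺′ (λ P → map (λ c → put c x P) corners) (splitBy∈splits col xs)
    (∈-map⁺ (λ c → put c x (splitBy col xs)) (∈-corners (col x)))

∈-splitBy⁻ : ∀ col L i {z} → z ∈ splitBy col L i → z ∈ L × col z ≡ i
∈-splitBy⁻ col (x ∷ xs) i z∈ with ∈-put⁻ (col x) x (splitBy col xs) i z∈
... | inj₁ (i≡ , refl) = here refl , sym i≡
... | inj₂ z∈′ = let z∈xs , col≡ = ∈-splitBy⁻ col xs i z∈′ in there z∈xs , col≡

∈-splitBy⁺ : ∀ col {L z} → z ∈ L → z ∈ splitBy col L (col z)
∈-splitBy⁺ col {x ∷ xs} (here refl) = subst (x ∈_) (sym (put-here (col x) x (splitBy col xs))) (here refl)
∈-splitBy⁺ col {x ∷ xs} (there z∈) = ∈-put⁺ (col x) x (splitBy col xs) _ (∈-splitBy⁺ col z∈)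

-- (m , P): an apex m ∈ R, and for each corner i the other vertices P i of R attached to it.
Decomposition : Set
Decomposition = ℕ × Parts

decompositions : List ℕ → List Decomposition
decompositions R = concatMap (λ p → map (proj₁ p ,_) (splits (proj₂ p))) (picks R)

∈-decompositions⁻ : ∀ {R m P} → (m , P) ∈ decompositions R → ∃[ R′ ] (m , R′) ∈ picks R × P ∈ splits R′
∈-decompositions⁻ {R} δ∈
  with (m , R′) , p∈ , δ∈′ ← ∈-concatMap⁻′ (λ p → map (proj₁ p ,_) (splits (proj₂ p))) (picks R) δ∈
  with _ , P∈ , refl ← ∈-map⁻ (m ,_) δ∈′ = R′ , p∈ , P∈

∈-decompositions⁺ : ∀ {R m R′ P} → (m , R′) ∈ picks R → P ∈ splits R′ → (m , P) ∈ decompositions R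
∈-decompositions⁺ p∈ P∈ = ∈-concatMap⁺′ (λ p → map (proj₁ p ,_) (splits (proj₂ p))) p∈ (∈-map⁺ _ P∈)

decompositions-distinct : ∀ {R} → Sorted R →
  AllPairs (λ δ δ′ → proj₁ δ ≢ proj₁ δ′ ⊎ ∃[ i ] proj₂ δ i ≢ proj₂ δ′ i) (decompositions R)
decompositions-distinct {R} s =
  AllPairs-concatMap⁺ (λ p → map (proj₁ p ,_) (splits (proj₂ p)))
    (λ p∈ → AllPairs.map⁺ (AllPairs.map inj₂ (splits-distinct (IsPick.rest-sorted (∈-picks⁻ s p∈)))))
    (picks-distinct s)
    across
  where
  across : ∀ {p p′ δ δ′} → p ∈ picks R → p′ ∈ picks R → proj₁ p ≢ proj₁ p′ →
    δ ∈ map (proj₁ p ,_) (splits (proj₂ p)) → δ′ ∈ map (proj₁ p′ ,_) (splits (proj₂ p′)) →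
    proj₁ δ ≢ proj₁ δ′ ⊎ ∃[ i ] proj₂ δ i ≢ proj₂ δ′ i
  across {p} {p′} _ _ m≢m′ δ∈ δ′∈
    with _ , _ , refl ← ∈-map⁻ (proj₁ p ,_) δ∈
    with _ , _ , refl ← ∈-map⁻ (proj₁ p′ ,_) δ′∈ = inj₁ m≢m′

decompositions-weight : ∀ u v w {R} → Sorted R →
  sum (map (weight u v w ∘ proj₂) (decompositions R)) ≡ length R * (u ⋆ (v ⋆ w)) (length R ∸ 1)
decompositions-weight u v w {R} s = begin
    sum (map (weight u v w ∘ proj₂) (decompositions R))
  ≡⟨ sum-concatMap (weight u v w ∘ proj₂) _ (picks R) ⟩
    sum (map (λ p → sum (map (weight u v w ∘ proj₂) (map (proj₁ p ,_) (splits (proj₂ p))))) (picks R))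
  ≡⟨ sum-map-const _ _ (picks R) per-pick ⟩
    length (picks R) * (u ⋆ (v ⋆ w)) (length R ∸ 1)
  ≡⟨ cong (_* (u ⋆ (v ⋆ w)) (length R ∸ 1)) (length-picks R) ⟩
    length R * (u ⋆ (v ⋆ w)) (length R ∸ 1)
  ∎
  where
  open ≡-Reasoning
  per-pick : ∀ {p} → p ∈ picks R →
    sum (map (weight u v w ∘ proj₂) (map (proj₁ p ,_) (splits (proj₂ p)))) ≡ (u ⋆ (v ⋆ w)) (length R ∸ 1)
  per-pick {m , R′} p∈ = begin
      sum (map (weight u v w ∘ proj₂) (map (m ,_) (splits R′)))
    ≡⟨ cong sum (sym (map-∘ (splits R′))) ⟩
      sum (map (weight u v w) (splits R′))
    ≡⟨ splits-weight u v w R′ ⟩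
      (u ⋆ (v ⋆ w)) (length R′)
    ≡⟨ cong (λ n → (u ⋆ (v ⋆ w)) (n ∸ 1)) (IsPick.length-rest (∈-picks⁻ s p∈)) ⟩
      (u ⋆ (v ⋆ w)) (length R ∸ 1)
    ∎

bool-cases : ∀ b → b ≡ true ⊎ b ≡ false
bool-cases true = inj₁ refl
bool-cases false = inj₂ refl

∨-true⁻ : ∀ a {b} → a ∨ b ≡ true → a ≡ true ⊎ b ≡ true
∨-true⁻ true _ = inj₁ refl
∨-true⁻ false b≡ = inj₂ b≡

∨-trueˡ : ∀ {a} b → a ≡ true → a ∨ b ≡ true
∨-trueˡ _ refl = refl

∨-trueʳ : ∀ a {b} → b ≡ true → a ∨ b ≡ true
∨-trueʳ true _ = refl
∨-trueʳ false b≡ = b≡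

∨-false : ∀ {a b} → a ≡ false → b ≡ false → a ∨ b ≡ false
∨-false refl refl = refl

∧-true⁻ : ∀ a {b} → a ∧ b ≡ true → a ≡ true × b ≡ true
∧-true⁻ true b≡ = refl , b≡

true≢false : true ≢ false
true≢false ()

≡ᵇ-true⁻ : ∀ x y → (x ≡ᵇ y) ≡ true → x ≡ y
≡ᵇ-true⁻ x y eq = ≡ᵇ⇒≡ x y (subst T (sym eq) tt)

≡ᵇ-refl : ∀ x → (x ≡ᵇ x) ≡ true
≡ᵇ-refl x with x ≡ᵇ x | ≡⇒≡ᵇ x x refl
... | true | _ = refl

≡ᵇ-false : ∀ x y → x ≢ y → (x ≡ᵇ y) ≡ false
≡ᵇ-false x y x≢y with x ≡ᵇ y in eq
... | true = ⊥-elim (x≢y (≡ᵇ-true⁻ x y eq))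
... | false = refl

∈?-true : ∀ {z W} → z ∈ W → ⌊ z ∈? W ⌋ ≡ true
∈?-true {z} {W} z∈ with z ∈? W
... | yes _ = refl
... | no z∉ = ⊥-elim (z∉ z∈)

samePair⁻ : ∀ a b x y → samePair a b x y ≡ true → (x ≡ a × y ≡ b) ⊎ (x ≡ b × y ≡ a)
samePair⁻ a b x y eq with ∨-true⁻ ((x ≡ᵇ a) ∧ (y ≡ᵇ b)) eq
... | inj₁ p = let x≡ , y≡ = ∧-true⁻ (x ≡ᵇ a) p in inj₁ (≡ᵇ-true⁻ x a x≡ , ≡ᵇ-true⁻ y b y≡)
... | inj₂ p = let x≡ , y≡ = ∧-true⁻ (x ≡ᵇ b) p in inj₂ (≡ᵇ-true⁻ x b x≡ , ≡ᵇ-true⁻ y a y≡)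

samePair-sym : ∀ a b x y → samePair a b x y ≡ samePair a b y x
samePair-sym a b x y =
  trans (∨-comm ((x ≡ᵇ a) ∧ (y ≡ᵇ b)) _) (cong₂ _∨_ (∧-comm (x ≡ᵇ b) (y ≡ᵇ a)) (∧-comm (x ≡ᵇ a) (y ≡ᵇ b)))

samePair-here : ∀ a b → samePair a b a b ≡ true
samePair-here a b rewrite ≡ᵇ-refl a | ≡ᵇ-refl b = refl

triangleEdges : ℕ → ℕ → ℕ → EdgeRel
triangleEdges a b c x y = samePair a b x y ∨ samePair a c x y ∨ samePair b c x y

data TriangleEdge (a b c : ℕ) : ℕ → ℕ → Set where
  ab : TriangleEdge a b c a b
  ba : TriangleEdge a b c b a
  ac : TriangleEdge a b c a c
  ca : TriangleEdge a b c c a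
  bc : TriangleEdge a b c b c
  cb : TriangleEdge a b c c b

triangleEdge⁻ : ∀ {a b c x y} → x ~[ triangleEdges a b c ] y → TriangleEdge a b c x y
triangleEdge⁻ {a} {b} {c} {x} {y} eq with ∨-true⁻ (samePair a b x y) eq
... | inj₁ p with samePair⁻ a b x y p
...   | inj₁ (refl , refl) = ab
...   | inj₂ (refl , refl) = ba
triangleEdge⁻ {a} {b} {c} {x} {y} eq | inj₂ q with ∨-true⁻ (samePair a c x y) q
...   | inj₁ p with samePair⁻ a c x y p
...     | inj₁ (refl , refl) = ac
...     | inj₂ (refl , refl) = ca
triangleEdge⁻ {a} {b} {c} {x} {y} eq | inj₂ q | inj₂ p with samePair⁻ b c x y p
...     | inj₁ (refl , refl) = bc
...     | inj₂ (refl , refl) = cb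

triangleEdges-sym : ∀ a b c x y → triangleEdges a b c x y ≡ triangleEdges a b c y x
triangleEdges-sym a b c x y =
  cong₂ _∨_ (samePair-sym a b x y) (cong₂ _∨_ (samePair-sym a c x y) (samePair-sym b c x y))

triangleEdge⁺ : ∀ {a b c x y} → TriangleEdge a b c x y → x ~[ triangleEdges a b c ] y
triangleEdge⁺ {a} {b} {c} ab = ∨-trueˡ _ (samePair-here a b)
triangleEdge⁺ {a} {b} {c} ba = trans (triangleEdges-sym a b c b a) (triangleEdge⁺ {a} {b} {c} ab)
triangleEdge⁺ {a} {b} {c} ac = ∨-trueʳ (samePair a b a c) (∨-trueˡ _ (samePair-here a c))
triangleEdge⁺ {a} {b} {c} ca = trans (triangleEdges-sym a b c c a) (triangleEdge⁺ {a} {b} {c} ac)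
triangleEdge⁺ {a} {b} {c} bc = ∨-trueʳ (samePair a b b c) (∨-trueʳ (samePair a c b c) (samePair-here b c))
triangleEdge⁺ {a} {b} {c} cb = trans (triangleEdges-sym a b c c b) (triangleEdge⁺ {a} {b} {c} bc)

removeTriangle⁻ : ∀ {E a b c x y} → x ~[ removeTriangle E a b c ] y → x ~[ E ] y × triangleEdges a b c x y ≡ false
removeTriangle⁻ {E} {a} {b} {c} {x} {y} eq with E x y | triangleEdges a b c x y
... | true | false = refl , refl

removeTriangle⁺ : ∀ {E a b c x y} → x ~[ E ] y → triangleEdges a b c x y ≡ false → x ~[ removeTriangle E a b c ] y
removeTriangle⁺ E≡ t≡ = cong₂ (λ e t → e ∧ not t) E≡ t≡

restrict⁻ : ∀ {E W x y} → x ~[ restrict E W ] y → x ~[ E ] y × x ∈ W × y ∈ W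
restrict⁻ {E} {W} {x} {y} eq with E x y | x ∈? W | y ∈? W
... | true | yes x∈ | yes y∈ = refl , x∈ , y∈

restrict⁺ : ∀ {E W x y} → x ~[ E ] y → x ∈ W → y ∈ W → x ~[ restrict E W ] y
restrict⁺ E≡ x∈ y∈ = cong₂ _∧_ E≡ (cong₂ _∧_ (∈?-true x∈) (∈?-true y∈))

_∪_ : EdgeRel → EdgeRel → EdgeRel
(E ∪ F) x y = E x y ∨ F x y

infixr 5 _∪_

∪⁻ : ∀ {E F x y} → x ~[ E ∪ F ] y → x ~[ E ] y ⊎ x ~[ F ] y
∪⁻ {E} = ∨-true⁻ (E _ _)

∪⁺ˡ : ∀ {E F x y} → x ~[ E ] y → x ~[ E ∪ F ] y
∪⁺ˡ {F = F} = ∨-trueˡ (F _ _)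

∪⁺ʳ : ∀ {E F x y} → x ~[ F ] y → x ~[ E ∪ F ] y
∪⁺ʳ {E} = ∨-trueʳ (E _ _)

path-map : ∀ {E F} → (∀ {x y} → x ~[ E ] y → x ~[ F ] y) → ∀ {x y} → Path E x y → Path F x y
path-map f here = here
path-map f (step e p) = step (f e) (path-map f p)

_++ᵖ_ : ∀ {E x y z} → Path E x y → Path E y z → Path E x z
here ++ᵖ q = q
step e p ++ᵖ q = step e (p ++ᵖ q)

path-reverse : ∀ {E} → (∀ x y → E x y ≡ E y x) → ∀ {x y} → Path E x y → Path E y x
path-reverse sym-E here = here
path-reverse sym-E (step {x} {y} e p) = path-reverse sym-E p ++ᵖ step (trans (sym-E y x) e) here

connected-via : ∀ {V E} → (∀ x y → E x y ≡ E y x) → ∀ c → (∀ x → x ∈ V → Path E x c) → Connected V E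
connected-via sym-E c to-c x y x∈ y∈ = to-c x x∈ ++ᵖ path-reverse sym-E (to-c y y∈)

simple-∪ : ∀ {V E F} → SimpleGraphOn V E → SimpleGraphOn V F → SimpleGraphOn V (E ∪ F)
simple-∪ {V} {E} {F} gE gF = record
  { symmetric = λ x y → cong₂ _∨_ (symmetric gE x y) (symmetric gF x y)
  ; loopless = λ x → ∨-false (loopless gE x) (loopless gF x)
  ; edgesInV = λ x y e → [ edgesInV gE x y , edgesInV gF x y ]′ (∪⁻ {E} {F} e) }
  where open SimpleGraphOn

simple-widen : ∀ {W V E} → SimpleGraphOn W E → W ⊆ V → SimpleGraphOn V E
simple-widen g W⊆V = record
  { symmetric = symmetric ; loopless = loopless
  ; edgesInV = λ x y e → let x∈ , y∈ = edgesInV x y e in W⊆V x∈ , W⊆V y∈ }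
  where open SimpleGraphOn g

simple-triangle : ∀ {V a b c} → a ≢ b → a ≢ c → b ≢ c → a ∈ V → b ∈ V → c ∈ V →
  SimpleGraphOn V (triangleEdges a b c)
simple-triangle {V} {a} {b} {c} a≢b a≢c b≢c a∈ b∈ c∈ = record
  { symmetric = triangleEdges-sym a b c ; loopless = loopless ; edgesInV = λ x y e → ends (triangleEdge⁻ e) }
  where
  loopless : ∀ x → triangleEdges a b c x x ≡ false
  loopless x with triangleEdges a b c x x in eq
  ... | false = refl
  ... | true with triangleEdge⁻ {a} {b} {c} {x} {x} eq
  ...   | ab = ⊥-elim (a≢b refl)
  ...   | ba = ⊥-elim (a≢b refl)
  ...   | ac = ⊥-elim (a≢c refl)
  ...   | ca = ⊥-elim (a≢c refl)
  ...   | bc = ⊥-elim (b≢c refl)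
  ...   | cb = ⊥-elim (b≢c refl)
  ends : ∀ {x y} → TriangleEdge a b c x y → x ∈ V × y ∈ V
  ends ab = a∈ , b∈
  ends ba = b∈ , a∈
  ends ac = a∈ , c∈
  ends ca = c∈ , a∈
  ends bc = b∈ , c∈
  ends cb = c∈ , b∈

simple-≈ : ∀ {V E F} → SimpleGraphOn V E → SameGraph E F → SimpleGraphOn V F
simple-≈ g E≈F = record
  { symmetric = λ x y → trans (sym (E≈F x y)) (trans (symmetric x y) (E≈F y x))
  ; loopless = λ x → trans (sym (E≈F x x)) (loopless x)
  ; edgesInV = λ x y e → edgesInV x y (trans (E≈F x y) e) }
  where open SimpleGraphOn g

edge-≈ : ∀ {E F} → SameGraph E F → ∀ {x y} → x ~[ E ] y → x ~[ F ] y
edge-≈ E≈F {x} {y} e = trans (sym (E≈F x y)) e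

connected-≈ : ∀ {V E F} → Connected V E → SameGraph E F → Connected V F
connected-≈ c E≈F x y x∈ y∈ = path-map (edge-≈ E≈F) (c x y x∈ y∈)

edgeCount-∪ : ∀ {V E F a b} → HasEdgeCount V E a → HasEdgeCount V F b →
  (∀ {x y} → x ~[ E ] y → F x y ≡ false) → HasEdgeCount V (E ∪ F) (a + b)
edgeCount-∪ {V} {E} {F} (LE , uE , lenE , iffE) (LF , uF , lenF , iffF) E∩F=∅ =
  LE ++ LF , Unique.++⁺ uE uF disjoint , trans (length-++ LE) (cong₂ _+_ lenE lenF) ,
  λ x y → mk⇔ (into x y) (outof x y)
  where
  open Equivalence
  disjoint : ∀ {p} → ¬ (p ∈ LE × p ∈ LF)
  disjoint {x , y} (p∈E , p∈F) =
    let _ , _ , _ , eE = to (iffE x y) p∈E ; _ , _ , _ , eF = to (iffF x y) p∈F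
    in true≢false (trans (sym eF) (E∩F=∅ eE))
  into : ∀ x y → (x , y) ∈ LE ++ LF → x < y × x ∈ V × y ∈ V × x ~[ E ∪ F ] y
  into x y p∈ with ∈-++⁻ LE p∈
  ... | inj₁ p∈E = let lt , x∈ , y∈ , e = to (iffE x y) p∈E in lt , x∈ , y∈ , ∪⁺ˡ {E} {F} e
  ... | inj₂ p∈F = let lt , x∈ , y∈ , e = to (iffF x y) p∈F in lt , x∈ , y∈ , ∪⁺ʳ {E} {F} e
  outof : ∀ x y → x < y × x ∈ V × y ∈ V × x ~[ E ∪ F ] y → (x , y) ∈ LE ++ LF
  outof x y (lt , x∈ , y∈ , e) with ∪⁻ {E} {F} e
  ... | inj₁ eE = ∈-++⁺ˡ (from (iffE x y) (lt , x∈ , y∈ , eE))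
  ... | inj₂ eF = ∈-++⁺ʳ LE (from (iffF x y) (lt , x∈ , y∈ , eF))

edgeCount-widen : ∀ {W V E k} → HasEdgeCount W E k → SimpleGraphOn W E → W ⊆ V → HasEdgeCount V E k
edgeCount-widen {W} {V} {E} (L , u , len , iff) g W⊆V = L , u , len , λ x y → mk⇔
  (λ p∈ → let lt , x∈ , y∈ , e = Equivalence.to (iff x y) p∈ in lt , W⊆V x∈ , W⊆V y∈ , e)
  (λ (lt , _ , _ , e) → let x∈ , y∈ = SimpleGraphOn.edgesInV g x y e in Equivalence.from (iff x y) (lt , x∈ , y∈ , e))

edgeCount-triangle : ∀ {V a b c} → a < b → b < c → a ∈ V → b ∈ V → c ∈ V → HasEdgeCount V (triangleEdges a b c) 3
edgeCount-triangle {V} {a} {b} {c} a<b b<c a∈ b∈ c∈ =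
  L , unique , refl , λ x y → mk⇔ to (λ (lt , _ , _ , e) → from lt (triangleEdge⁻ e))
  where
  a<c = <-trans a<b b<c
  L = (a , b) ∷ (a , c) ∷ (b , c) ∷ []
  fst-differs : ∀ {p q r s : ℕ} → p < q → (p , r) ≢ (q , s)
  fst-differs lt refl = <-irrefl refl lt
  snd-differs : ∀ {p q r : ℕ} → q < r → (p , q) ≢ (p , r)
  snd-differs lt refl = <-irrefl refl lt
  unique : Unique L
  unique = (snd-differs b<c ∷ fst-differs a<b ∷ []) ∷ (fst-differs a<b ∷ []) ∷ [] ∷ []
  to : ∀ {x y} → (x , y) ∈ L → x < y × x ∈ V × y ∈ V × x ~[ triangleEdges a b c ] y
  to (here refl) = a<b , a∈ , b∈ , triangleEdge⁺ {a} {b} {c} ab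
  to (there (here refl)) = a<c , a∈ , c∈ , triangleEdge⁺ {a} {b} {c} ac
  to (there (there (here refl))) = b<c , b∈ , c∈ , triangleEdge⁺ {a} {b} {c} bc
  from : ∀ {x y} → x < y → TriangleEdge a b c x y → (x , y) ∈ L
  from _ ab = here refl
  from _ ac = there (here refl)
  from _ bc = there (there (here refl))
  from lt ba = ⊥-elim (<-asym lt a<b)
  from lt ca = ⊥-elim (<-asym lt a<c)
  from lt cb = ⊥-elim (<-asym lt b<c)

edgeCount-transport : ∀ {S V G E c} → HasEdgeCount S G c → S ⊆ V → V ⊆ S → SameGraph E G → HasEdgeCount V E c
edgeCount-transport (L , unique , len , iff) S⊆V V⊆S E≈G = L , unique , len , λ x y → mk⇔
  (λ p∈ → let lt , x∈ , y∈ , e = Equivalence.to (iff x y) p∈ in lt , S⊆V x∈ , S⊆V y∈ , trans (E≈G x y) e)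
  (λ (lt , x∈ , y∈ , e) → Equivalence.from (iff x y) (lt , V⊆S x∈ , V⊆S y∈ , trans (sym (E≈G x y)) e))

removeTriangle-≈ : ∀ {E F} a b c → SameGraph E F → SameGraph (removeTriangle E a b c) (removeTriangle F a b c)
removeTriangle-≈ a b c E≈F x y = cong (λ e → e ∧ not (triangleEdges a b c x y)) (E≈F x y)

restrict-≈ : ∀ {E F} W → SameGraph E F → SameGraph (restrict E W) (restrict F W)
restrict-≈ W E≈F x y = cong (λ e → e ∧ ⌊ x ∈? W ⌋ ∧ ⌊ y ∈? W ⌋) (E≈F x y)

threeComponents-≈ : ∀ {V E F V₁ V₂ V₃} → ThreeComponents V E V₁ V₂ V₃ → SameGraph E F → ThreeComponents V F V₁ V₂ V₃
threeComponents-≈ {V₁ = V₁} {V₂} {V₃}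
    (cover , ne₁ , ne₂ , ne₃ , d₁₂ , d₁₃ , d₂₃ , n₁₂ , n₁₃ , n₂₃ , n₂₁ , n₃₁ , n₃₂ , k₁ , k₂ , k₃) E≈F =
  cover , ne₁ , ne₂ , ne₃ , d₁₂ , d₁₃ , d₂₃ , none n₁₂ , none n₁₃ , none n₂₃ , none n₂₁ , none n₃₁ , none n₃₂ ,
  connected-≈ k₁ (restrict-≈ V₁ E≈F) , connected-≈ k₂ (restrict-≈ V₂ E≈F) , connected-≈ k₃ (restrict-≈ V₃ E≈F)
  where
  none : ∀ {A B} → NoEdgesBetween _ A B → NoEdgesBetween _ A B
  none n x y x∈ y∈ = trans (sym (E≈F x y)) (n x y x∈ y∈)

tree-≈ : ∀ {V E F} → TreeOfTriangles V E → SameGraph E F → TreeOfTriangles V F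
tree-≈ (single g c v V≡v) E≈F = single (simple-≈ g E≈F) (connected-≈ c E≈F) v V≡v
tree-≈ {E = E} {F} (triangle g c v₁ v₂ m first second e₁₂ m∈ m≢v₁ m≢v₂ e₁ₘ e₂ₘ apex! V₁ V₂ V₃ comps t₁ t₂ t₃) E≈F =
  triangle (simple-≈ g E≈F) (connected-≈ c E≈F) v₁ v₂ m first second (edge-≈ E≈F e₁₂) m∈ m≢v₁ m≢v₂
    (edge-≈ E≈F e₁ₘ) (edge-≈ E≈F e₂ₘ)
    (λ m′ m′∈ ≢v₁ ≢v₂ e₁ e₂ → apex! m′ m′∈ ≢v₁ ≢v₂ (trans (E≈F v₁ m′) e₁) (trans (E≈F v₂ m′) e₂))
    V₁ V₂ V₃ (threeComponents-≈ comps E≈F′) (sub t₁) (sub t₂) (sub t₃)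
  where
  E≈F′ = removeTriangle-≈ v₁ v₂ m E≈F
  sub : ∀ {W} → TreeOfTriangles W (restrict (removeTriangle E v₁ v₂ m) W) →
        TreeOfTriangles W (restrict (removeTriangle F v₁ v₂ m) W)
  sub {W} t = tree-≈ t (restrict-≈ W E≈F′)

tree-resp-⊆ : ∀ {V V′ E} → TreeOfTriangles V E → V ⊆ V′ → V′ ⊆ V → TreeOfTriangles V′ E
tree-resp-⊆ (single g c v V≡v) V⊆ ⊆V =
  single (simple-widen g V⊆) (λ x y x∈ y∈ → c x y (⊆V x∈) (⊆V y∈)) v
    (λ x → mk⇔ (λ x∈ → Equivalence.to (V≡v x) (⊆V x∈)) (λ x≡ → V⊆ (Equivalence.from (V≡v x) x≡)))
tree-resp-⊆ (triangle g c v₁ v₂ m (v₁∈ , v₁≤) (v₂∈ , v₂≢v₁ , v₂≤) e₁₂ m∈ m≢v₁ m≢v₂ e₁ₘ e₂ₘ apex! V₁ V₂ V₃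
    (cover , rest) t₁ t₂ t₃) V⊆ ⊆V =
  triangle (simple-widen g V⊆) (λ x y x∈ y∈ → c x y (⊆V x∈) (⊆V y∈)) v₁ v₂ m
    (V⊆ v₁∈ , λ w w∈ → v₁≤ w (⊆V w∈)) (V⊆ v₂∈ , v₂≢v₁ , λ w w∈ → v₂≤ w (⊆V w∈))
    e₁₂ (V⊆ m∈) m≢v₁ m≢v₂ e₁ₘ e₂ₘ (λ m′ m′∈ → apex! m′ (⊆V m′∈)) V₁ V₂ V₃
    ((λ x → mk⇔ (λ x∈ → Equivalence.to (cover x) (⊆V x∈)) (λ x∈ → V⊆ (Equivalence.from (cover x) x∈))) , rest)
    t₁ t₂ t₃

tree-simple : ∀ {V E} → TreeOfTriangles V E → SimpleGraphOn V E
tree-simple (single g _ _ _) = g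
tree-simple (triangle g _ _ _ _ _ _ _ _ _ _ _ _ _ _ _ _ _ _ _ _) = g

tree-connected : ∀ {V E} → TreeOfTriangles V E → Connected V E
tree-connected (single _ c _ _) = c
tree-connected (triangle _ c _ _ _ _ _ _ _ _ _ _ _ _ _ _ _ _ _ _ _) = c

-- Perfect matchings

indicator : ℕ → ℕ → ℕ
indicator w a = if w ≡ᵇ a then 1 else 0

indicator-≢ : ∀ w a → a ≢ w → indicator w a ≡ 0
indicator-≢ w a a≢w rewrite ≡ᵇ-false w a (a≢w ∘ sym) = refl

indicator-refl : ∀ w → indicator w w ≡ 1
indicator-refl w rewrite ≡ᵇ-refl w = refl

incidences-++ : ∀ w M M′ → incidences w (M ++ M′) ≡ incidences w M + incidences w M′
incidences-++ w [] M′ = refl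
incidences-++ w (p ∷ M) M′ =
  trans (cong (indicator w (proj₁ p) + indicator w (proj₂ p) +_) (incidences-++ w M M′))
        (sym (+-assoc (indicator w (proj₁ p) + indicator w (proj₂ p)) _ _))

incidences-avoiding : ∀ w M → All (λ p → proj₁ p ≢ w × proj₂ p ≢ w) M → incidences w M ≡ 0
incidences-avoiding w [] [] = refl
incidences-avoiding w (p ∷ M) ((≢₁ , ≢₂) ∷ avoid) =
  cong₂ _+_ (cong₂ _+_ (indicator-≢ w _ ≢₁) (indicator-≢ w _ ≢₂)) (incidences-avoiding w M avoid)

incidences-outside : ∀ {V E v M} w → PerfectMatchingMinus V E v M → w ∉ V → incidences w M ≡ 0
incidences-outside w (pairs , _) w∉ =
  incidences-avoiding w _ (All.map (λ (_ , a∈ , b∈ , _) → (λ { refl → w∉ a∈ }) , (λ { refl → w∉ b∈ })) pairs)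

incidences-deleted : ∀ {V E v M} → PerfectMatchingMinus V E v M → incidences v M ≡ 0
incidences-deleted (pairs , _) = incidences-avoiding _ _ (All.map (λ (_ , _ , _ , ≢v , ≢v′) → ≢v , ≢v′) pairs)

perfectMatching-glue : ∀ {S A B C G Ea Eb Ec v rb rc Ma Mb Mc} →
  (∀ {z} → z ∈ S → z ∈ A ⊎ z ∈ B ⊎ z ∈ C) → A ⊆ S → B ⊆ S → C ⊆ S →
  Disjoint A B → Disjoint A C → Disjoint B C →
  (∀ {x y} → x ~[ Ea ] y → x ~[ G ] y) → (∀ {x y} → x ~[ Eb ] y → x ~[ G ] y) → (∀ {x y} → x ~[ Ec ] y → x ~[ G ] y) →
  v ∈ A → rb ∈ B → rc ∈ C → rb ~[ G ] rc →
  PerfectMatchingMinus A Ea v Ma → PerfectMatchingMinus B Eb rb Mb → PerfectMatchingMinus C Ec rc Mc →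
  PerfectMatchingMinus S G v ((rb , rc) ∷ Ma ++ Mb ++ Mc)
perfectMatching-glue {S} {A} {B} {C} {v = v} {rb} {rc} {Ma} {Mb} {Mc} cover A⊆ B⊆ C⊆ A∩B A∩C B∩C Ea⊆ Eb⊆ Ec⊆
    v∈ rb∈ rc∈ rb~rc pmA@(pairsA , countA) pmB@(pairsB , countB) pmC@(pairsC , countC) =
  (rb~rc , B⊆ rb∈ , C⊆ rc∈ , (λ { refl → A∩B _ v∈ rb∈ }) , (λ { refl → A∩C _ v∈ rc∈ }))
  ∷ All.++⁺ (All.map (λ (e , a∈ , b∈ , ≢₁ , ≢₂) → Ea⊆ e , A⊆ a∈ , A⊆ b∈ , ≢₁ , ≢₂) pairsA)
      (All.++⁺ (All.map (λ (e , a∈ , b∈ , _ , _) → Eb⊆ e , B⊆ a∈ , B⊆ b∈ , ≢v a∈ , ≢v b∈) pairsB)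
               (All.map (λ (e , a∈ , b∈ , _ , _) → Ec⊆ e , C⊆ a∈ , C⊆ b∈ , ≢v′ a∈ , ≢v′ b∈) pairsC))
  , count
  where
  ≢v : ∀ {z} → z ∈ B → z ≢ v
  ≢v z∈ refl = A∩B _ v∈ z∈
  ≢v′ : ∀ {z} → z ∈ C → z ≢ v
  ≢v′ z∈ refl = A∩C _ v∈ z∈
  count-from : ∀ w {x₁ x₂ x₃ x₄ x₅} → indicator w rb ≡ x₁ → indicator w rc ≡ x₂ →
    incidences w Ma ≡ x₃ → incidences w Mb ≡ x₄ → incidences w Mc ≡ x₅ →
    incidences w ((rb , rc) ∷ Ma ++ Mb ++ Mc) ≡ (x₁ + x₂) + (x₃ + (x₄ + x₅))
  count-from w p₁ p₂ p₃ p₄ p₅ =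
    trans (cong (indicator w rb + indicator w rc +_)
                (trans (incidences-++ w Ma (Mb ++ Mc)) (cong (incidences w Ma +_) (incidences-++ w Mb Mc))))
          (cong₂ _+_ (cong₂ _+_ p₁ p₂) (cong₂ _+_ p₃ (cong₂ _+_ p₄ p₅)))
  count : ∀ w → w ∈ S → w ≢ v → incidences w ((rb , rc) ∷ Ma ++ Mb ++ Mc) ≡ 1
  count w w∈ w≢v with cover w∈
  ... | inj₁ w∈A = count-from w (indicator-≢ w rb λ { refl → A∩B _ w∈A rb∈ }) (indicator-≢ w rc λ { refl → A∩C _ w∈A rc∈ })
        (countA w w∈A w≢v) (incidences-outside w pmB (A∩B _ w∈A)) (incidences-outside w pmC (A∩C _ w∈A))
  ... | inj₂ (inj₁ w∈B) with w ≟ rb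
  ...   | yes refl = count-from w (indicator-refl w) (indicator-≢ w rc λ { refl → B∩C _ w∈B rc∈ })
          (incidences-outside w pmA (λ w∈A → A∩B _ w∈A w∈B)) (incidences-deleted pmB) (incidences-outside w pmC (B∩C _ w∈B))
  ...   | no w≢rb = count-from w (indicator-≢ w rb (w≢rb ∘ sym)) (indicator-≢ w rc λ { refl → B∩C _ w∈B rc∈ })
          (incidences-outside w pmA (λ w∈A → A∩B _ w∈A w∈B)) (countB w w∈B w≢rb) (incidences-outside w pmC (B∩C _ w∈B))
  count w w∈ w≢v | inj₂ (inj₂ w∈C) with w ≟ rc
  ...   | yes refl = count-from w (indicator-≢ w rb λ { refl → B∩C _ rb∈ w∈C }) (indicator-refl w)
          (incidences-outside w pmA (λ w∈A → A∩C _ w∈A w∈C)) (incidences-outside w pmB (λ w∈B → B∩C _ w∈B w∈C))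
          (incidences-deleted pmC)
  ...   | no w≢rc = count-from w (indicator-≢ w rb λ { refl → B∩C _ rb∈ w∈C }) (indicator-≢ w rc (w≢rc ∘ sym))
          (incidences-outside w pmA (λ w∈A → A∩C _ w∈A w∈C)) (incidences-outside w pmB (λ w∈B → B∩C _ w∈B w∈C))
          (countC w w∈C w≢rc)

factorCritical-transport : ∀ {S V G E} → FactorCritical S G → S ⊆ V → V ⊆ S → SameGraph E G → FactorCritical V E
factorCritical-transport fc S⊆V V⊆S E≈G v v∈ with M , pairs , count ← fc v (V⊆S v∈) =
  M , All.map (λ (e , a∈ , b∈ , ≢₁ , ≢₂) → trans (E≈G _ _) e , S⊆V a∈ , S⊆V b∈ , ≢₁ , ≢₂) pairs ,
  λ w w∈ w≢v → count w (V⊆S w∈) w≢v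

-- Gluing three graphs along a triangle

glue : ℕ → ℕ → ℕ → (Corner → EdgeRel) → EdgeRel
glue a b c E = triangleEdges a b c ∪ E c₁ ∪ E c₂ ∪ E c₃

glue⁺ : ∀ {a b c} E i {x y} → x ~[ E i ] y → x ~[ glue a b c E ] y
glue⁺ {a} {b} {c} E c₁ {x} {y} e = ∨-trueʳ (triangleEdges a b c x y) (∨-trueˡ _ e)
glue⁺ {a} {b} {c} E c₂ {x} {y} e = ∨-trueʳ (triangleEdges a b c x y) (∨-trueʳ (E c₁ x y) (∨-trueˡ _ e))
glue⁺ {a} {b} {c} E c₃ {x} {y} e = ∨-trueʳ (triangleEdges a b c x y) (∨-trueʳ (E c₁ x y) (∨-trueʳ (E c₂ x y) e))

glue⁻ : ∀ {a b c} E {x y} → x ~[ glue a b c E ] y → TriangleEdge a b c x y ⊎ ∃[ i ] x ~[ E i ] y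
glue⁻ {a} {b} {c} E {x} {y} e with ∨-true⁻ (triangleEdges a b c x y) e
... | inj₁ t = inj₁ (triangleEdge⁻ t)
... | inj₂ e′ with ∨-true⁻ (E c₁ x y) e′
...   | inj₁ e₁ = inj₂ (c₁ , e₁)
...   | inj₂ e″ with ∨-true⁻ (E c₂ x y) e″
...     | inj₁ e₂ = inj₂ (c₂ , e₂)
...     | inj₂ e₃ = inj₂ (c₃ , e₃)

glue-≈ : ∀ {a b c E F} → (∀ i → SameGraph (E i) (F i)) → SameGraph (glue a b c E) (glue a b c F)
glue-≈ {a} {b} {c} E≈F x y =
  cong (triangleEdges a b c x y ∨_) (cong₂ _∨_ (E≈F c₁ x y) (cong₂ _∨_ (E≈F c₂ x y) (E≈F c₃ x y)))

record RootedPartition (V : List ℕ) (W : Corner → List ℕ) (root : Corner → ℕ) : Set where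
  field
    cover : ∀ {z} → z ∈ V → ∃[ i ] z ∈ W i
    W⊆V : ∀ i → W i ⊆ V
    disjoint : ∀ {i j z} → z ∈ W i → z ∈ W j → i ≡ j
    root∈ : ∀ i → root i ∈ W i

module Glue (S : List ℕ) (W : Corner → List ℕ) (E : Corner → EdgeRel) (a b c : ℕ)
  (partition : RootedPartition S W (triple a b c))
  (simple : ∀ i → SimpleGraphOn (W i) (E i))
  (connected : ∀ i → Connected (W i) (E i))
  where

  open RootedPartition partition renaming (W⊆V to W⊆S)

  G : EdgeRel
  G = glue a b c E

  G′ : EdgeRel
  G′ = removeTriangle G a b c

  root : Corner → ℕ
  root = triple a b c

  root-in : ∀ {i j} → root j ∈ W i → j ≡ i
  root-in {i} {j} r∈ = disjoint (root∈ j) r∈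

  a≢b : a ≢ b
  a≢b a≡b = case root-in {c₂} {c₁} (subst (_∈ W c₂) (sym a≡b) (root∈ c₂)) of λ ()

  a≢c : a ≢ c
  a≢c a≡c = case root-in {c₃} {c₁} (subst (_∈ W c₃) (sym a≡c) (root∈ c₃)) of λ ()

  b≢c : b ≢ c
  b≢c b≡c = case root-in {c₃} {c₂} (subst (_∈ W c₃) (sym b≡c) (root∈ c₃)) of λ ()

  part-edge : ∀ i {x y} → x ~[ E i ] y → x ∈ W i × y ∈ W i
  part-edge i {x} {y} = SimpleGraphOn.edgesInV (simple i) x y

  E⊆G : ∀ i {x y} → x ~[ E i ] y → x ~[ G ] y
  E⊆G = glue⁺ E

  triangle-crosses : ∀ {i x y} → TriangleEdge a b c x y → x ∈ W i → y ∈ W i → ⊥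
  triangle-crosses ab x∈ y∈ = case trans (root-in {j = c₁} x∈) (sym (root-in {j = c₂} y∈)) of λ ()
  triangle-crosses ba x∈ y∈ = case trans (root-in {j = c₂} x∈) (sym (root-in {j = c₁} y∈)) of λ ()
  triangle-crosses ac x∈ y∈ = case trans (root-in {j = c₁} x∈) (sym (root-in {j = c₃} y∈)) of λ ()
  triangle-crosses ca x∈ y∈ = case trans (root-in {j = c₃} x∈) (sym (root-in {j = c₁} y∈)) of λ ()
  triangle-crosses bc x∈ y∈ = case trans (root-in {j = c₂} x∈) (sym (root-in {j = c₃} y∈)) of λ ()
  triangle-crosses cb x∈ y∈ = case trans (root-in {j = c₃} x∈) (sym (root-in {j = c₂} y∈)) of λ ()

  not-triangle : ∀ i {x y} → x ~[ E i ] y → triangleEdges a b c x y ≡ false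
  not-triangle i {x} {y} e with triangleEdges a b c x y in t
  ... | false = refl
  ... | true = ⊥-elim (triangle-crosses (triangleEdge⁻ t) (proj₁ (part-edge i e)) (proj₂ (part-edge i e)))

  E⊆G′ : ∀ i {x y} → x ~[ E i ] y → x ~[ G′ ] y
  E⊆G′ i {x} {y} e = removeTriangle⁺ {G} {a} {b} {c} {x} {y} (E⊆G i e) (not-triangle i e)

  G⁻ : ∀ {x y} → x ~[ G ] y → TriangleEdge a b c x y ⊎ ∃[ i ] x ~[ E i ] y
  G⁻ = glue⁻ E

  G′⁻ : ∀ {x y} → x ~[ G′ ] y → ∃[ i ] x ~[ E i ] y
  G′⁻ {x} {y} e with removeTriangle⁻ {G} {a} {b} {c} {x} {y} e
  ... | eG , not-t with G⁻ eG
  ...   | inj₂ part = part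
  ...   | inj₁ t = ⊥-elim (true≢false (trans (sym (triangleEdge⁺ t)) not-t))

  G′-crossing : ∀ {i j x y} → x ∈ W i → y ∈ W j → i ≢ j → G′ x y ≡ false
  G′-crossing {i} {j} {x} {y} x∈ y∈ i≢j with G′ x y in e
  ... | false = refl
  ... | true = let k , eₖ = G′⁻ e ; x∈ₖ , y∈ₖ = part-edge k eₖ
               in ⊥-elim (i≢j (trans (disjoint x∈ x∈ₖ) (disjoint y∈ₖ y∈)))

  restrict-G′ : ∀ i → SameGraph (restrict G′ (W i)) (E i)
  restrict-G′ i x y with E i x y in e
  ... | true = restrict⁺ {G′} {W i} {x} {y} (E⊆G′ i e) (proj₁ (part-edge i e)) (proj₂ (part-edge i e))
  ... | false with restrict G′ (W i) x y in r
  ...   | false = refl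
  ...   | true
    with e′ , x∈ , _ ← restrict⁻ {G′} {W i} {x} {y} r
    with k , eₖ ← G′⁻ e′
    with refl ← disjoint x∈ (proj₁ (part-edge k eₖ)) = ⊥-elim (true≢false (trans (sym eₖ) e))

  path-stays : ∀ {i x y} → Path G′ x y → x ∈ W i → y ∈ W i
  path-stays here x∈ = x∈
  path-stays (step e p) x∈ with k , eₖ ← G′⁻ e with disjoint x∈ (proj₁ (part-edge k eₖ))
  ... | refl = path-stays p (proj₂ (part-edge k eₖ))

  triangle⊆G : ∀ {x y} → TriangleEdge a b c x y → x ~[ G ] y
  triangle⊆G t = ∨-trueˡ _ (triangleEdge⁺ t)

  simpleGraph : SimpleGraphOn S G
  simpleGraph =
    simple-∪ (simple-triangle a≢b a≢c b≢c (W⊆S c₁ (root∈ c₁)) (W⊆S c₂ (root∈ c₂)) (W⊆S c₃ (root∈ c₃)))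
      (simple-∪ (part c₁) (simple-∪ (part c₂) (part c₃)))
    where
    part : ∀ i → SimpleGraphOn S (E i)
    part i = simple-widen (simple i) (W⊆S i)

  connectedGraph : Connected S G
  connectedGraph = connected-via (SimpleGraphOn.symmetric simpleGraph) a to-a
    where
    to-root : ∀ i {x} → x ∈ W i → Path G x (root i)
    to-root i x∈ = path-map (E⊆G i) (connected i _ _ x∈ (root∈ i))
    to-a : ∀ x → x ∈ S → Path G x a
    to-a x x∈ with cover x∈
    ... | c₁ , x∈₁ = to-root c₁ x∈₁
    ... | c₂ , x∈₂ = to-root c₂ x∈₂ ++ᵖ step (triangle⊆G ba) here
    ... | c₃ , x∈₃ = to-root c₃ x∈₃ ++ᵖ step (triangle⊆G ca) here

  apex-unique : ∀ m′ → m′ ≢ a → m′ ≢ b → a ~[ G ] m′ → b ~[ G ] m′ → m′ ≡ c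
  apex-unique m′ m′≢a m′≢b e₁ e₂ with G⁻ {a} {m′} e₁ | G⁻ {b} {m′} e₂
  ... | inj₁ ab | _ = ⊥-elim (m′≢b refl)
  ... | inj₁ ac | _ = refl
  ... | inj₁ ba | _ = ⊥-elim (a≢b refl)
  ... | inj₁ bc | _ = ⊥-elim (a≢b refl)
  ... | inj₁ ca | _ = ⊥-elim (a≢c refl)
  ... | inj₁ cb | _ = ⊥-elim (a≢c refl)
  ... | inj₂ _ | inj₁ ab = ⊥-elim (a≢b refl)
  ... | inj₂ _ | inj₁ ac = ⊥-elim (a≢b refl)
  ... | inj₂ _ | inj₁ ba = ⊥-elim (m′≢a refl)
  ... | inj₂ _ | inj₁ bc = refl
  ... | inj₂ _ | inj₁ ca = ⊥-elim (b≢c refl)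
  ... | inj₂ _ | inj₁ cb = ⊥-elim (b≢c refl)
  ... | inj₂ (i , eᵢ) | inj₂ (j , eⱼ)
    with refl ← root-in {i} {c₁} (proj₁ (part-edge i eᵢ))
    with refl ← root-in {j} {c₂} (proj₁ (part-edge j eⱼ))
    with () ← disjoint (proj₂ (part-edge c₁ eᵢ)) (proj₂ (part-edge c₂ eⱼ))

  cover₃ : ∀ {z} → z ∈ S → z ∈ W c₁ ⊎ z ∈ W c₂ ⊎ z ∈ W c₃
  cover₃ z∈ with cover z∈
  ... | c₁ , z∈₁ = inj₁ z∈₁
  ... | c₂ , z∈₂ = inj₂ (inj₁ z∈₂)
  ... | c₃ , z∈₃ = inj₂ (inj₂ z∈₃)

  apart : ∀ {i j} → i ≢ j → Disjoint (W i) (W j)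
  apart i≢j _ z∈ᵢ z∈ⱼ = i≢j (disjoint z∈ᵢ z∈ⱼ)

  threeComponents : ThreeComponents S G′ (W c₁) (W c₂) (W c₃)
  threeComponents =
    (λ z → mk⇔ cover₃ [ W⊆S c₁ , [ W⊆S c₂ , W⊆S c₃ ]′ ]′) ,
    (a , root∈ c₁) , (b , root∈ c₂) , (c , root∈ c₃) ,
    apart (λ ()) , apart (λ ()) , apart (λ ()) ,
    crossing (λ ()) , crossing (λ ()) , crossing (λ ()) , crossing (λ ()) , crossing (λ ()) , crossing (λ ()) ,
    inside c₁ , inside c₂ , inside c₃
    where
    crossing : ∀ {i j} → i ≢ j → NoEdgesBetween G′ (W i) (W j)
    crossing i≢j _ _ x∈ y∈ = G′-crossing x∈ y∈ i≢j
    inside : ∀ i → Connected (W i) (restrict G′ (W i))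
    inside i = connected-≈ (connected i) (λ x y → sym (restrict-G′ i x y))

  treeOfTriangles : IsFirst S a → IsSecond S a b → (∀ i → TreeOfTriangles (W i) (E i)) → TreeOfTriangles S G
  treeOfTriangles first second trees =
    triangle simpleGraph connectedGraph a b c first second (triangle⊆G ab) (W⊆S c₃ (root∈ c₃))
      (a≢c ∘ sym) (b≢c ∘ sym) (triangle⊆G ac) (triangle⊆G bc) (λ m′ _ → apex-unique m′)
      (W c₁) (W c₂) (W c₃) threeComponents (part c₁) (part c₂) (part c₃)
    where
    part : ∀ i → TreeOfTriangles (W i) (restrict G′ (W i))
    part i = tree-≈ (trees i) (λ x y → sym (restrict-G′ i x y))

  factorCritical : (∀ i → FactorCritical (W i) (E i)) → FactorCritical S G
  factorCritical fc v v∈ with cover v∈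
  ... | c₁ , v∈₁ = _ ,
    perfectMatching-glue cover₃ (W⊆S c₁) (W⊆S c₂) (W⊆S c₃) (apart (λ ())) (apart (λ ())) (apart (λ ()))
      (E⊆G c₁) (E⊆G c₂) (E⊆G c₃) v∈₁ (root∈ c₂) (root∈ c₃) (triangle⊆G bc)
      (matching c₁ v∈₁) (matching c₂ (root∈ c₂)) (matching c₃ (root∈ c₃))
    where matching = λ i {u} (u∈ : u ∈ W i) → proj₂ (fc i u u∈)
  ... | c₂ , v∈₂ = _ ,
    perfectMatching-glue (λ z∈ → [ inj₂ ∘ inj₁ , [ inj₁ , inj₂ ∘ inj₂ ]′ ]′ (cover₃ z∈))
      (W⊆S c₂) (W⊆S c₁) (W⊆S c₃) (apart (λ ())) (apart (λ ())) (apart (λ ()))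
      (E⊆G c₂) (E⊆G c₁) (E⊆G c₃) v∈₂ (root∈ c₁) (root∈ c₃) (triangle⊆G ac)
      (matching c₂ v∈₂) (matching c₁ (root∈ c₁)) (matching c₃ (root∈ c₃))
    where matching = λ i {u} (u∈ : u ∈ W i) → proj₂ (fc i u u∈)
  ... | c₃ , v∈₃ = _ ,
    perfectMatching-glue (λ z∈ → [ inj₂ ∘ inj₁ , [ inj₂ ∘ inj₂ , inj₁ ]′ ]′ (cover₃ z∈))
      (W⊆S c₃) (W⊆S c₁) (W⊆S c₂) (apart (λ ())) (apart (λ ())) (apart (λ ()))
      (E⊆G c₃) (E⊆G c₁) (E⊆G c₂) v∈₃ (root∈ c₁) (root∈ c₂) (triangle⊆G ab)
      (matching c₃ v∈₃) (matching c₁ (root∈ c₁)) (matching c₂ (root∈ c₂))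
    where matching = λ i {u} (u∈ : u ∈ W i) → proj₂ (fc i u u∈)

  edgeCount : a < b → b < c → ∀ {k : Corner → ℕ} → (∀ i → HasEdgeCount (W i) (E i) (k i)) →
    HasEdgeCount S G (3 + (k c₁ + (k c₂ + k c₃)))
  edgeCount a<b b<c counts =
    edgeCount-∪ (edgeCount-triangle a<b b<c (W⊆S c₁ (root∈ c₁)) (W⊆S c₂ (root∈ c₂)) (W⊆S c₃ (root∈ c₃)))
      (edgeCount-∪ (part c₁) (edgeCount-∪ (part c₂) (part c₃) (apart-edges (λ ())))
        (λ e → ∨-false (apart-edges (λ ()) e) (apart-edges (λ ()) e)))
      (λ t → ∨-false (not-part c₁ t) (∨-false (not-part c₂ t) (not-part c₃ t)))
    where
    part : ∀ i → HasEdgeCount S (E i) _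
    part i = edgeCount-widen (counts i) (simple i) (W⊆S i)
    apart-edges : ∀ {i j x y} → i ≢ j → x ~[ E i ] y → E j x y ≡ false
    apart-edges {i} {j} {x} {y} i≢j e with E j x y in e′
    ... | false = refl
    ... | true = ⊥-elim (i≢j (disjoint (proj₁ (part-edge i e)) (proj₁ (part-edge j e′))))
    not-part : ∀ i {x y} → x ~[ triangleEdges a b c ] y → E i x y ≡ false
    not-part i {x} {y} t with E i x y in e
    ... | false = refl
    ... | true = ⊥-elim (triangle-crosses (triangleEdge⁻ t) (proj₁ (part-edge i e)) (proj₂ (part-edge i e)))

-- The enumeration

noEdges : EdgeRel
noEdges _ _ = false

component : ℕ → ℕ → Decomposition → Corner → List ℕ
component s₁ s₂ δ c₁ = s₁ ∷ proj₂ δ c₁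
component s₁ s₂ δ c₂ = s₂ ∷ proj₂ δ c₂
component s₁ s₂ δ c₃ = insert (proj₁ δ) (proj₂ δ c₃)

sorted-first : ∀ {s₁ S} → Sorted (s₁ ∷ S) → IsFirst (s₁ ∷ S) s₁
sorted-first s = here refl , λ { _ (here refl) → ≤-refl ; _ (there w∈) → <⇒≤ (sorted-head s w∈) }

sorted-second : ∀ {s₁ s₂ R} → Sorted (s₁ ∷ s₂ ∷ R) → IsSecond (s₁ ∷ s₂ ∷ R) s₁ s₂
sorted-second s =
  there (here refl) , (λ s₂≡s₁ → head-∉-tail s (here (sym s₂≡s₁))) ,
  λ { _ (here refl) w≢s₁ → ⊥-elim (w≢s₁ refl) ; _ (there (here refl)) _ → ≤-refl
    ; _ (there (there w∈)) _ → <⇒≤ (sorted-head (AllPairs.tail s) w∈) }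

module Decomposed {s₁ s₂ : ℕ} {R : List ℕ} (sorted-S : Sorted (s₁ ∷ s₂ ∷ R))
  {m : ℕ} {P : Parts} (δ∈ : (m , P) ∈ decompositions R) where

  S : List ℕ
  S = s₁ ∷ s₂ ∷ R

  W : Corner → List ℕ
  W = component s₁ s₂ (m , P)

  root : Corner → ℕ
  root = triple s₁ s₂ m

  private
    origin = ∈-decompositions⁻ {R} δ∈
    R′ = proj₁ origin
    pick : IsPick R m R′
    pick = ∈-picks⁻ (AllPairs.tail (AllPairs.tail sorted-S)) (proj₁ (proj₂ origin))
    split : IsSplit R′ P
    split = ∈-splits⁻ (IsPick.rest-sorted pick) (proj₂ (proj₂ origin))
    open IsPick pick
    open IsSplit split renaming (sorted to parts-sorted; disjoint to parts-disjoint; cover to parts-cover)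

  P⊆R : ∀ i → P i ⊆ R
  P⊆R i = rest⊆ ∘ ⊆L i

  m∈R : m ∈ R
  m∈R = picked∈

  root∉P : ∀ i j → root i ∉ P j
  root∉P c₁ j s₁∈ = head-∉-tail sorted-S (there (P⊆R j s₁∈))
  root∉P c₂ j s₂∈ = head-∉-tail (AllPairs.tail sorted-S) (P⊆R j s₂∈)
  root∉P c₃ j m∈ = picked∉ (⊆L j m∈)

  ∈-W⁻ : ∀ i {z} → z ∈ W i → z ≡ root i ⊎ z ∈ P i
  ∈-W⁻ c₁ (here z≡) = inj₁ z≡
  ∈-W⁻ c₁ (there z∈) = inj₂ z∈
  ∈-W⁻ c₂ (here z≡) = inj₁ z≡
  ∈-W⁻ c₂ (there z∈) = inj₂ z∈
  ∈-W⁻ c₃ z∈ = ∈-insert⁻ m (P c₃) z∈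

  root∈ : ∀ i → root i ∈ W i
  root∈ c₁ = here refl
  root∈ c₂ = here refl
  root∈ c₃ = ∈-insert⁺ˡ m (P c₃)

  P⊆W : ∀ i → P i ⊆ W i
  P⊆W c₁ = there
  P⊆W c₂ = there
  P⊆W c₃ = ∈-insert⁺ʳ m (P c₃)

  root∈S : ∀ i → root i ∈ S
  root∈S c₁ = here refl
  root∈S c₂ = there (here refl)
  root∈S c₃ = there (there m∈R)

  W⊆S : ∀ i → W i ⊆ S
  W⊆S i z∈ with ∈-W⁻ i z∈
  ... | inj₁ refl = root∈S i
  ... | inj₂ z∈P = there (there (P⊆R i z∈P))

  cover : ∀ {z} → z ∈ S → ∃[ i ] z ∈ W i
  cover (here refl) = c₁ , here refl
  cover (there (here refl)) = c₂ , here refl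
  cover {z} (there (there z∈R)) with z ≟ m
  ... | yes refl = c₃ , root∈ c₃
  ... | no z≢m = let i , z∈P = parts-cover (⊆rest z∈R z≢m) in i , P⊆W i z∈P

  root-injective : ∀ i j → root i ≡ root j → i ≡ j
  root-injective c₁ c₁ _ = refl
  root-injective c₂ c₂ _ = refl
  root-injective c₃ c₃ _ = refl
  root-injective c₁ c₂ s₁≡s₂ = ⊥-elim (<-irrefl s₁≡s₂ (sorted-head sorted-S (here refl)))
  root-injective c₂ c₁ s₂≡s₁ = ⊥-elim (<-irrefl (sym s₂≡s₁) (sorted-head sorted-S (here refl)))
  root-injective c₁ c₃ s₁≡m = ⊥-elim (<-irrefl s₁≡m (sorted-head sorted-S (there m∈R)))
  root-injective c₃ c₁ m≡s₁ = ⊥-elim (<-irrefl (sym m≡s₁) (sorted-head sorted-S (there m∈R)))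
  root-injective c₂ c₃ s₂≡m = ⊥-elim (<-irrefl s₂≡m (sorted-head (AllPairs.tail sorted-S) m∈R))
  root-injective c₃ c₂ m≡s₂ = ⊥-elim (<-irrefl (sym m≡s₂) (sorted-head (AllPairs.tail sorted-S) m∈R))

  root-apart : ∀ {i j} → root i ∈ W j → i ≡ j
  root-apart {i} {j} r∈ with ∈-W⁻ j r∈
  ... | inj₁ r≡ = root-injective i j r≡
  ... | inj₂ r∈P = ⊥-elim (root∉P i j r∈P)

  disjoint : ∀ {i j z} → z ∈ W i → z ∈ W j → i ≡ j
  disjoint {i} {j} z∈i z∈j with ∈-W⁻ i z∈i | ∈-W⁻ j z∈j
  ... | inj₁ refl | _ = root-apart z∈j
  ... | inj₂ _ | inj₁ refl = sym (root-apart z∈i)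
  ... | inj₂ z∈Pi | inj₂ z∈Pj = parts-disjoint z∈Pi z∈Pj

  partition : RootedPartition S W root
  partition = record { cover = cover ; W⊆V = W⊆S ; disjoint = disjoint ; root∈ = root∈ }

  P-sorted : ∀ i → Sorted (P i)
  P-sorted = parts-sorted

  W-sorted : ∀ i → Sorted (W i)
  W-sorted c₁ = sorted-cons (λ z∈ → sorted-head sorted-S (there (P⊆R c₁ z∈))) (parts-sorted c₁)
  W-sorted c₂ = sorted-cons (λ z∈ → sorted-head (AllPairs.tail sorted-S) (P⊆R c₂ z∈)) (parts-sorted c₂)
  W-sorted c₃ = insert-sorted m (P c₃) (parts-sorted c₃)

  length-W : ∀ i → length (W i) ≡ suc (length (P i))
  length-W c₁ = refl
  length-W c₂ = refl
  length-W c₃ = length-insert m (P c₃) (root∉P c₃ c₃)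

  length-S : length S ≡ 3 + (length (P c₁) + length (P c₂) + length (P c₃))
  length-S = cong (2 +_) (trans (sym length-rest) (cong suc (sym total-length)))

  W-shorter : ∀ i → length (W i) ≤ length R
  W-shorter i = ≤-trans (≤-reflexive (length-W i)) (≤-trans (s≤s (part≤ i)) (≤-reflexive length-rest))
    where
    part≤ : ∀ i → length (P i) ≤ length R′
    part≤ c₁ = ≤-trans (≤-trans (m≤m+n _ _) (m≤m+n _ _)) (≤-reflexive total-length)
    part≤ c₂ = ≤-trans (≤-trans (m≤n+m _ (length (P c₁))) (m≤m+n _ _)) (≤-reflexive total-length)
    part≤ c₃ = ≤-trans (m≤n+m _ _) (≤-reflexive total-length)

record CertifiedTree (V : List ℕ) (E : EdgeRel) : Set where
  field
    tree : TreeOfTriangles V E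
    factorCritical : FactorCritical V E
    half : ℕ
    size : length V ≡ suc (2 * half)
    edgeCount : HasEdgeCount V E (3 * half)

certified-single : ∀ s → CertifiedTree (s ∷ []) noEdges
certified-single s = record
  { tree = single simple (λ { _ _ (here refl) (here refl) → here }) s
                (λ _ → mk⇔ (λ { (here z≡s) → z≡s }) λ { refl → here refl })
  ; factorCritical = λ { _ (here refl) → [] , [] , λ { _ (here refl) w≢s → ⊥-elim (w≢s refl) } }
  ; half = 0
  ; size = refl
  ; edgeCount = [] , [] , refl , λ _ _ → mk⇔ (λ ()) λ () }
  where
  simple : SimpleGraphOn (s ∷ []) noEdges
  simple = record { symmetric = λ _ _ → refl ; loopless = λ _ → refl ; edgesInV = λ _ _ () }

module Glued {s₁ s₂ : ℕ} {R : List ℕ} (sorted-S : Sorted (s₁ ∷ s₂ ∷ R))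
  {m : ℕ} {P : Parts} (δ∈ : (m , P) ∈ decompositions R)
  (E : Corner → EdgeRel) (certified : ∀ i → CertifiedTree (Decomposed.W sorted-S δ∈ i) (E i)) where

  open Decomposed sorted-S δ∈ public

  tree : ∀ i → TreeOfTriangles (W i) (E i)
  tree i = CertifiedTree.tree (certified i)

  open Glue S W E s₁ s₂ m partition (λ i → tree-simple (tree i)) (λ i → tree-connected (tree i)) public hiding (root)

  certified-glue : CertifiedTree S G
  certified-glue = record
    { tree = treeOfTriangles (sorted-first sorted-S) (sorted-second sorted-S) tree
    ; factorCritical = factorCritical (λ i → CertifiedTree.factorCritical (certified i))
    ; half = suc (h c₁ + h c₂ + h c₃)
    ; size = size
    ; edgeCount = subst (HasEdgeCount S G) edges
        (edgeCount (sorted-head sorted-S (here refl)) (sorted-head (AllPairs.tail sorted-S) m∈R)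
                   (λ i → CertifiedTree.edgeCount (certified i))) }
    where
    h : Corner → ℕ
    h i = CertifiedTree.half (certified i)
    edges : 3 + (3 * h c₁ + (3 * h c₂ + 3 * h c₃)) ≡ 3 * suc (h c₁ + h c₂ + h c₃)
    edges = solve 3 (λ a b c → con 3 :+ (con 3 :* a :+ (con 3 :* b :+ con 3 :* c)) := con 3 :* (con 1 :+ (a :+ b :+ c)))
                    refl (h c₁) (h c₂) (h c₃)
    length-P : ∀ i → length (P i) ≡ 2 * h i
    length-P i = suc-injective (trans (sym (length-W i)) (CertifiedTree.size (certified i)))
    size : length S ≡ suc (2 * suc (h c₁ + h c₂ + h c₃))
    size = begin
        length S
      ≡⟨ length-S ⟩
        3 + (length (P c₁) + length (P c₂) + length (P c₃))
      ≡⟨ cong (3 +_) (cong₂ _+_ (cong₂ _+_ (length-P c₁) (length-P c₂)) (length-P c₃)) ⟩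
        3 + (2 * h c₁ + 2 * h c₂ + 2 * h c₃)
      ≡⟨ solve 3 (λ a b c → con 3 :+ (con 2 :* a :+ con 2 :* b :+ con 2 :* c) := con 1 :+ con 2 :* (con 1 :+ (a :+ b :+ c)))
                refl (h c₁) (h c₂) (h c₃) ⟩
        suc (2 * suc (h c₁ + h c₂ + h c₃))
      ∎
      where open ≡-Reasoning

-- n is fuel: the list is complete only when n ≥ length S.
treesOn : ℕ → List ℕ → List EdgeRel
treesOn zero _ = []
treesOn (suc n) [] = []
treesOn (suc n) (s ∷ []) = noEdges ∷ []
treesOn (suc n) (s₁ ∷ s₂ ∷ R) =
  concatMap (λ δ → map (glue s₁ s₂ (proj₁ δ)) (choices (treesOn n ∘ component s₁ s₂ δ))) (decompositions R)

∈-treesOn⁻ : ∀ {n s₁ s₂ R G} → G ∈ treesOn (suc n) (s₁ ∷ s₂ ∷ R) →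
  ∃[ m ] ∃[ P ] ∃[ E ] (m , P) ∈ decompositions R × (∀ i → E i ∈ treesOn n (component s₁ s₂ (m , P) i)) × G ≡ glue s₁ s₂ m E
∈-treesOn⁻ {n} {s₁} {s₂} {R} G∈
  with (m , P) , δ∈ , G∈′
         ← ∈-concatMap⁻′ (λ δ → map (glue s₁ s₂ (proj₁ δ)) (choices (treesOn n ∘ component s₁ s₂ δ))) (decompositions R) G∈
  with E , E∈ , refl ← ∈-map⁻ (glue s₁ s₂ m) G∈′ =
  m , P , E , δ∈ , ∈-choices⁻ (treesOn n ∘ component s₁ s₂ (m , P)) E∈ , refl

treesOn-certified : ∀ n {S} → Sorted S → length S ≤ n → All (CertifiedTree S) (treesOn n S)
treesOn-certified zero _ _ = []
treesOn-certified (suc n) {[]} _ _ = []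
treesOn-certified (suc n) {s ∷ []} _ _ = certified-single s ∷ []
treesOn-certified (suc n) {s₁ ∷ s₂ ∷ R} sorted-S (s≤s |R|<n) = All.tabulate certify
  where
  certify : ∀ {G} → G ∈ treesOn (suc n) (s₁ ∷ s₂ ∷ R) → CertifiedTree (s₁ ∷ s₂ ∷ R) G
  certify G∈ with m , P , E , δ∈ , E∈ , refl ← ∈-treesOn⁻ {n} {s₁} {s₂} {R} G∈ =
    Glued.certified-glue sorted-S δ∈ E λ i →
      All.lookup (treesOn-certified n (W-sorted i) (≤-trans (W-shorter i) (<⇒≤ |R|<n))) (E∈ i)
    where open Decomposed sorted-S δ∈

length-treesOn : ∀ n {S k} → Sorted S → length S ≤ n → length S ≡ suc k → length (treesOn n S) ≡ τ k
length-treesOn zero {[]} _ _ ()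
length-treesOn (suc n) {s ∷ []} _ _ refl = refl
length-treesOn (suc n) {s₁ ∷ s₂ ∷ R} sorted-S (s≤s |R|<n) refl = begin
    length (concatMap gluings (decompositions R))
  ≡⟨ length-concatMap gluings (decompositions R) ⟩
    sum (map (length ∘ gluings) (decompositions R))
  ≡⟨ sum-map-cong (decompositions R) count ⟩
    sum (map (weight τ τ τ ∘ proj₂) (decompositions R))
  ≡⟨ decompositions-weight τ τ τ (AllPairs.tail (AllPairs.tail sorted-S)) ⟩
    length R * (τ ⋆ (τ ⋆ τ)) (length R ∸ 1)
  ≡⟨ τ-suc (length R) ⟩
    τ (suc (length R))
  ∎
  where
  open ≡-Reasoning
  gluings : Decomposition → List EdgeRel
  gluings δ = map (glue s₁ s₂ (proj₁ δ)) (choices (treesOn n ∘ component s₁ s₂ δ))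
  count : ∀ {δ} → δ ∈ decompositions R → length (gluings δ) ≡ weight τ τ τ (proj₂ δ)
  count {m , P} δ∈ = begin
      length (gluings (m , P))
    ≡⟨ length-map _ (choices (treesOn n ∘ W)) ⟩
      length (choices (treesOn n ∘ W))
    ≡⟨ length-choices (treesOn n ∘ W) ⟩
      length (treesOn n (W c₁)) * (length (treesOn n (W c₂)) * length (treesOn n (W c₃)))
    ≡⟨ cong₂ _*_ (trees c₁) (cong₂ _*_ (trees c₂) (trees c₃)) ⟩
      weight τ τ τ P
    ∎
    where
    open Decomposed sorted-S δ∈
    trees : ∀ i → length (treesOn n (W i)) ≡ τ (length (P i))
    trees i = length-treesOn n (W-sorted i) (≤-trans (W-shorter i) (<⇒≤ |R|<n)) (length-W i)

module _ {s₁ s₂ : ℕ} {R : List ℕ} (sorted-S : Sorted (s₁ ∷ s₂ ∷ R))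
  {m : ℕ} {P : Parts} (δ∈ : (m , P) ∈ decompositions R)
  {E : Corner → EdgeRel} (cert : ∀ i → CertifiedTree (component s₁ s₂ (m , P) i) (E i))
  {m′ : ℕ} {P′ : Parts} (δ′∈ : (m′ , P′) ∈ decompositions R)
  {E′ : Corner → EdgeRel} (cert′ : ∀ i → CertifiedTree (component s₁ s₂ (m′ , P′) i) (E′ i))
  where

  private
    module X = Glued sorted-S δ∈ E cert
    module Y = Glued sorted-S δ′∈ E′ cert′

  glue-apex : SameGraph (glue s₁ s₂ m E) (glue s₁ s₂ m′ E′) → m ≡ m′
  glue-apex same =
    Y.apex-unique m (λ m≡s₁ → case X.root-injective c₃ c₁ m≡s₁ of λ ()) (λ m≡s₂ → case X.root-injective c₃ c₂ m≡s₂ of λ ())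
      (edge-≈ same {s₁} {m} (X.triangle⊆G ac)) (edge-≈ same {s₂} {m} (X.triangle⊆G bc))

  -- A component is what its root reaches once the triangle is removed.
  glue-component-⊆ : m ≡ m′ → SameGraph (glue s₁ s₂ m E) (glue s₁ s₂ m′ E′) → ∀ i → X.W i ⊆ Y.W i
  glue-component-⊆ refl same i z∈ =
    Y.path-stays {i} (path-map {E i} {Y.G′} (λ {x} {y} e → edge-≈ (removeTriangle-≈ s₁ s₂ m same) {x} {y} (X.E⊆G′ i e))
                                (tree-connected (X.tree i) _ _ (X.root∈ i) z∈))
                     (Y.root∈ i)

  glue-part-⊆ : m ≡ m′ → SameGraph (glue s₁ s₂ m E) (glue s₁ s₂ m′ E′) → ∀ i → P i ⊆ P′ i
  glue-part-⊆ refl same i z∈ with Y.∈-W⁻ i (glue-component-⊆ refl same i (X.P⊆W i z∈))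
  ... | inj₁ refl = ⊥-elim (X.root∉P i i z∈)
  ... | inj₂ z∈′ = z∈′

  glue-parts-≈ : (m≡m′ : m ≡ m′) → SameGraph (glue s₁ s₂ m E) (glue s₁ s₂ m′ E′) → X.W ≗ Y.W → ∀ i → SameGraph (E i) (E′ i)
  glue-parts-≈ refl same W≡ i x y = begin
      E i x y
    ≡⟨ sym (X.restrict-G′ i x y) ⟩
      restrict X.G′ (X.W i) x y
    ≡⟨ restrict-≈ (X.W i) (removeTriangle-≈ s₁ s₂ m same) x y ⟩
      restrict Y.G′ (X.W i) x y
    ≡⟨ cong (λ V → restrict Y.G′ V x y) (W≡ i) ⟩
      restrict Y.G′ (Y.W i) x y
    ≡⟨ Y.restrict-G′ i x y ⟩
      E′ i x y
    ∎
    where open ≡-Reasoning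

glue-injective : ∀ {s₁ s₂ R} (sorted-S : Sorted (s₁ ∷ s₂ ∷ R))
  {m P} (δ∈ : (m , P) ∈ decompositions R) {E} (cert : ∀ i → CertifiedTree (component s₁ s₂ (m , P) i) (E i)) →
  ∀ {m′ P′} (δ′∈ : (m′ , P′) ∈ decompositions R) {E′} (cert′ : ∀ i → CertifiedTree (component s₁ s₂ (m′ , P′) i) (E′ i)) →
  SameGraph (glue s₁ s₂ m E) (glue s₁ s₂ m′ E′) → m ≡ m′ × (∀ i → P i ≡ P′ i) × (∀ i → SameGraph (E i) (E′ i))
glue-injective sorted-S δ∈ cert δ′∈ cert′ same
  with refl ← glue-apex sorted-S δ∈ cert δ′∈ cert′ same =
  refl ,
  (λ i → sorted-extensionality (X.P-sorted i) (Y.P-sorted i) (glue-part-⊆ sorted-S δ∈ cert δ′∈ cert′ refl same i)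
                               (glue-part-⊆ sorted-S δ′∈ cert′ δ∈ cert refl (λ x y → sym (same x y)) i)) ,
  glue-parts-≈ sorted-S δ∈ cert δ′∈ cert′ refl same λ i →
    sorted-extensionality (X.W-sorted i) (Y.W-sorted i) (glue-component-⊆ sorted-S δ∈ cert δ′∈ cert′ refl same i)
                          (glue-component-⊆ sorted-S δ′∈ cert′ δ∈ cert refl (λ x y → sym (same x y)) i)
  where
  module X = Decomposed sorted-S δ∈
  module Y = Decomposed sorted-S δ′∈

treesOn-distinct : ∀ n {S} → Sorted S → length S ≤ n → AllPairs (λ E F → ¬ SameGraph E F) (treesOn n S)
treesOn-distinct zero _ _ = []
treesOn-distinct (suc n) {[]} _ _ = []
treesOn-distinct (suc n) {s ∷ []} _ _ = [] ∷ []
treesOn-distinct (suc n) {s₁ ∷ s₂ ∷ R} sorted-S (s≤s |R|<n) =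
  AllPairs-concatMap⁺ gluings inside (decompositions-distinct (AllPairs.tail (AllPairs.tail sorted-S))) across
  where
  gluings : Decomposition → List EdgeRel
  gluings δ = map (glue s₁ s₂ (proj₁ δ)) (choices (treesOn n ∘ component s₁ s₂ δ))
  fuel : ∀ {δ} (δ∈ : δ ∈ decompositions R) i → length (component s₁ s₂ δ i) ≤ n
  fuel {m , P} δ∈ i = ≤-trans (Decomposed.W-shorter sorted-S δ∈ i) (<⇒≤ |R|<n)
  certified : ∀ {δ} (δ∈ : δ ∈ decompositions R) {E} → E ∈ choices (treesOn n ∘ component s₁ s₂ δ) →
    ∀ i → CertifiedTree (component s₁ s₂ δ i) (E i)
  certified {m , P} δ∈ E∈ i =
    All.lookup (treesOn-certified n (Decomposed.W-sorted sorted-S δ∈ i) (fuel δ∈ i))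
               (∈-choices⁻ (treesOn n ∘ component s₁ s₂ (m , P)) E∈ i)
  inside : ∀ {δ} → δ ∈ decompositions R → AllPairs (λ E F → ¬ SameGraph E F) (gluings δ)
  inside {m , P} δ∈ =
    AllPairs.map⁺ (AllPairs-map∈
      (λ E∈ F∈ (i , Eᵢ≉Fᵢ) same →
        Eᵢ≉Fᵢ (proj₂ (proj₂ (glue-injective sorted-S δ∈ (certified δ∈ E∈) δ∈ (certified δ∈ F∈) same)) i))
      (AllPairs-choices (λ i → treesOn-distinct n (Decomposed.W-sorted sorted-S δ∈ i) (fuel δ∈ i))))
  across : ∀ {δ δ′ G G′} → δ ∈ decompositions R → δ′ ∈ decompositions R →
    proj₁ δ ≢ proj₁ δ′ ⊎ ∃[ i ] proj₂ δ i ≢ proj₂ δ′ i → G ∈ gluings δ → G′ ∈ gluings δ′ → ¬ SameGraph G G′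
  across {m , P} {m′ , P′} δ∈ δ′∈ differ G∈ G′∈ same
    with E , E∈ , refl ← ∈-map⁻ (glue s₁ s₂ m) G∈
    with E′ , E′∈ , refl ← ∈-map⁻ (glue s₁ s₂ m′) G′∈
    with m≡m′ , P≡P′ , _ ← glue-injective sorted-S δ∈ (certified δ∈ E∈) δ′∈ (certified δ′∈ E′∈) same
    with differ
  ... | inj₁ m≢m′ = m≢m′ m≡m′
  ... | inj₂ (i , Pᵢ≢P′ᵢ) = Pᵢ≢P′ᵢ (P≡P′ i)

-- Completeness of the enumeration

other : Corner → Corner → Corner
other c₁ c₁ = c₂
other c₁ c₂ = c₃
other c₁ c₃ = c₂
other c₂ c₁ = c₃
other c₂ c₂ = c₁
other c₂ c₃ = c₁
other c₃ c₁ = c₂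
other c₃ c₂ = c₁
other c₃ c₃ = c₁

other-≢ : ∀ i j → other i j ≢ i × other i j ≢ j
other-≢ c₁ c₁ = (λ ()) , (λ ())
other-≢ c₁ c₂ = (λ ()) , (λ ())
other-≢ c₁ c₃ = (λ ()) , (λ ())
other-≢ c₂ c₁ = (λ ()) , (λ ())
other-≢ c₂ c₂ = (λ ()) , (λ ())
other-≢ c₂ c₃ = (λ ()) , (λ ())
other-≢ c₃ c₁ = (λ ()) , (λ ())
other-≢ c₃ c₂ = (λ ()) , (λ ())
other-≢ c₃ c₃ = (λ ()) , (λ ())

covering-distinct : ∀ {i j k} → (∀ l → l ≡ i ⊎ l ≡ j ⊎ l ≡ k) → i ≢ j
covering-distinct {i} {j} {k} cover refl with cover (other i k) | other-≢ i k
... | inj₁ l≡i | l≢i , _ = l≢i l≡i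
... | inj₂ (inj₁ l≡i) | l≢i , _ = l≢i l≡i
... | inj₂ (inj₂ l≡k) | _ , l≢k = l≢k l≡k

onto⇒injective : ∀ (f : Corner → Corner) → (∀ j → ∃[ i ] f i ≡ j) → ∀ {i i′} → f i ≡ f i′ → i ≡ i′
onto⇒injective f onto {i} {i′} f≡ with i ≟ᶜ i′
... | yes i≡i′ = i≡i′
... | no i≢i′ = ⊥-elim (apart i i′ i≢i′ f≡)
  where
  cover : ∀ l → l ≡ f c₁ ⊎ l ≡ f c₂ ⊎ l ≡ f c₃
  cover l with onto l
  ... | c₁ , refl = inj₁ refl
  ... | c₂ , refl = inj₂ (inj₁ refl)
  ... | c₃ , refl = inj₂ (inj₂ refl)
  permute : ∀ {a b c} → (∀ l → l ≡ a ⊎ l ≡ b ⊎ l ≡ c) → ∀ l → l ≡ a ⊎ l ≡ c ⊎ l ≡ b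
  permute cov l with cov l
  ... | inj₁ e = inj₁ e
  ... | inj₂ (inj₁ e) = inj₂ (inj₂ e)
  ... | inj₂ (inj₂ e) = inj₂ (inj₁ e)
  rotate : ∀ {a b c} → (∀ l → l ≡ a ⊎ l ≡ b ⊎ l ≡ c) → ∀ l → l ≡ b ⊎ l ≡ c ⊎ l ≡ a
  rotate cov l with cov l
  ... | inj₁ e = inj₂ (inj₂ e)
  ... | inj₂ (inj₁ e) = inj₁ e
  ... | inj₂ (inj₂ e) = inj₂ (inj₁ e)
  apart : ∀ i i′ → i ≢ i′ → f i ≢ f i′
  apart c₁ c₁ ne = ⊥-elim (ne refl)
  apart c₂ c₂ ne = ⊥-elim (ne refl)
  apart c₃ c₃ ne = ⊥-elim (ne refl)
  apart c₁ c₂ _ = covering-distinct cover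
  apart c₂ c₁ _ = covering-distinct cover ∘ sym
  apart c₁ c₃ _ = covering-distinct (permute cover)
  apart c₃ c₁ _ = covering-distinct (permute cover) ∘ sym
  apart c₂ c₃ _ = covering-distinct (rotate cover)
  apart c₃ c₂ _ = covering-distinct (rotate cover) ∘ sym

triangle-source : ∀ {a b c x y} → TriangleEdge a b c x y → ∃[ i ] triple a b c i ≡ x
triangle-source ab = c₁ , refl
triangle-source ba = c₂ , refl
triangle-source ac = c₁ , refl
triangle-source ca = c₃ , refl
triangle-source bc = c₂ , refl
triangle-source cb = c₃ , refl

module _ {V : List ℕ} {F : EdgeRel} {V₁ V₂ V₃ : List ℕ} (components : ThreeComponents V F V₁ V₂ V₃) where

  private
    Vs : Corner → List ℕ
    Vs = triple V₁ V₂ V₃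

  components-cover : ∀ {z} → z ∈ V → ∃[ i ] z ∈ Vs i
  components-cover {z} z∈ with Equivalence.to (proj₁ components z) z∈
  ... | inj₁ z∈₁ = c₁ , z∈₁
  ... | inj₂ (inj₁ z∈₂) = c₂ , z∈₂
  ... | inj₂ (inj₂ z∈₃) = c₃ , z∈₃

  components-⊆ : ∀ i → Vs i ⊆ V
  components-⊆ c₁ {z} z∈ = Equivalence.from (proj₁ components z) (inj₁ z∈)
  components-⊆ c₂ {z} z∈ = Equivalence.from (proj₁ components z) (inj₂ (inj₁ z∈))
  components-⊆ c₃ {z} z∈ = Equivalence.from (proj₁ components z) (inj₂ (inj₂ z∈))

  components-nonempty : ∀ i → ∃[ z ] z ∈ Vs i
  components-nonempty c₁ = proj₁ (proj₂ components)
  components-nonempty c₂ = proj₁ (proj₂ (proj₂ components))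
  components-nonempty c₃ = proj₁ (proj₂ (proj₂ (proj₂ components)))

  components-disjoint : ∀ {i j z} → z ∈ Vs i → z ∈ Vs j → i ≡ j
  components-disjoint {i} {j} = go i j components
    where
    go : ∀ i j → ThreeComponents V F V₁ V₂ V₃ → ∀ {z} → z ∈ Vs i → z ∈ Vs j → i ≡ j
    go c₁ c₁ _ _ _ = refl
    go c₂ c₂ _ _ _ = refl
    go c₃ c₃ _ _ _ = refl
    go c₁ c₂ (_ , _ , _ , _ , d₁₂ , _) p q = ⊥-elim (d₁₂ _ p q)
    go c₁ c₃ (_ , _ , _ , _ , _ , d₁₃ , _) p q = ⊥-elim (d₁₃ _ p q)
    go c₂ c₃ (_ , _ , _ , _ , _ , _ , d₂₃ , _) p q = ⊥-elim (d₂₃ _ p q)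
    go c₂ c₁ (_ , _ , _ , _ , d₁₂ , _) p q = ⊥-elim (d₁₂ _ q p)
    go c₃ c₁ (_ , _ , _ , _ , _ , d₁₃ , _) p q = ⊥-elim (d₁₃ _ q p)
    go c₃ c₂ (_ , _ , _ , _ , _ , _ , d₂₃ , _) p q = ⊥-elim (d₂₃ _ q p)

  components-separated : ∀ {i j x y} → x ∈ Vs i → y ∈ Vs j → i ≢ j → F x y ≡ false
  components-separated {i} {j} = go i j components
    where
    go : ∀ i j → ThreeComponents V F V₁ V₂ V₃ → ∀ {x y} → x ∈ Vs i → y ∈ Vs j → i ≢ j → F x y ≡ false
    go c₁ c₁ _ _ _ i≢j = ⊥-elim (i≢j refl)
    go c₂ c₂ _ _ _ i≢j = ⊥-elim (i≢j refl)
    go c₃ c₃ _ _ _ i≢j = ⊥-elim (i≢j refl)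
    go c₁ c₂ (_ , _ , _ , _ , _ , _ , _ , n₁₂ , _) p q _ = n₁₂ _ _ p q
    go c₁ c₃ (_ , _ , _ , _ , _ , _ , _ , _ , n₁₃ , _) p q _ = n₁₃ _ _ p q
    go c₂ c₃ (_ , _ , _ , _ , _ , _ , _ , _ , _ , n₂₃ , _) p q _ = n₂₃ _ _ p q
    go c₂ c₁ (_ , _ , _ , _ , _ , _ , _ , _ , _ , _ , n₂₁ , _) p q _ = n₂₁ _ _ p q
    go c₃ c₁ (_ , _ , _ , _ , _ , _ , _ , _ , _ , _ , _ , n₃₁ , _) p q _ = n₃₁ _ _ p q
    go c₃ c₂ (_ , _ , _ , _ , _ , _ , _ , _ , _ , _ , _ , _ , n₃₂ , _) p q _ = n₃₂ _ _ p q

module TopTriangle {V : List ℕ} {E : EdgeRel} {a b c : ℕ} {V₁ V₂ V₃ : List ℕ}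
  (g : SimpleGraphOn V E) (connected : Connected V E)
  (a∈ : a ∈ V) (b∈ : b ∈ V) (c∈ : c ∈ V)
  (components : ThreeComponents V (removeTriangle E a b c) V₁ V₂ V₃) where

  root : Corner → ℕ
  root = triple a b c

  root∈V : ∀ i → root i ∈ V
  root∈V c₁ = a∈
  root∈V c₂ = b∈
  root∈V c₃ = c∈

  Vs : Corner → List ℕ
  Vs = triple V₁ V₂ V₃

  private
    cover-Vs = components-cover components
    Vs⊆V = components-⊆ components
    separated-Vs = components-separated components
    disjoint-Vs = components-disjoint components

  -- Walking from inside a component towards a, the first edge that leaves it is a triangle edge.
  has-root : ∀ j → ∃[ i ] root i ∈ Vs j
  has-root j = walk (connected _ a (Vs⊆V j (proj₂ z∈)) a∈) (proj₂ z∈)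
    where
    z∈ = components-nonempty components j
    walk : ∀ {x} → Path E x a → x ∈ Vs j → ∃[ i ] root i ∈ Vs j
    walk here a∈ⱼ = c₁ , a∈ⱼ
    walk {x} (step {y = y} e p) x∈ with triangleEdges a b c x y in t
    ... | true = let i , rᵢ≡x = triangle-source (triangleEdge⁻ {a} {b} {c} {x} {y} t) in i , subst (_∈ Vs j) (sym rᵢ≡x) x∈
    ... | false with k , y∈ ← cover-Vs (proj₂ (SimpleGraphOn.edgesInV g x y e)) with j ≟ᶜ k
    ...   | yes refl = walk p y∈
    ...   | no j≢k =
      ⊥-elim (true≢false (trans (sym (removeTriangle⁺ {E} {a} {b} {c} {x} {y} e t)) (separated-Vs x∈ y∈ j≢k)))

  π : Corner → Corner
  π i = proj₁ (cover-Vs (root∈V i))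

  π-onto : ∀ j → ∃[ i ] π i ≡ j
  π-onto j = let i , rᵢ∈ = has-root j in i , disjoint-Vs (proj₂ (cover-Vs (root∈V i))) rᵢ∈

  π-injective : ∀ {i j} → π i ≡ π j → i ≡ j
  π-injective = onto⇒injective π π-onto

  W : Corner → List ℕ
  W i = Vs (π i)

  partition : RootedPartition V W root
  partition = record
    { cover = λ z∈ → let j , z∈ⱼ = cover-Vs z∈ ; i , πi≡j = π-onto j in i , subst (λ k → _ ∈ Vs k) (sym πi≡j) z∈ⱼ
    ; W⊆V = λ i → Vs⊆V (π i)
    ; disjoint = λ p q → π-injective (disjoint-Vs p q)
    ; root∈ = λ i → proj₂ (cover-Vs (root∈V i)) }

  separated : ∀ {i j x y} → x ∈ W i → y ∈ W j → i ≢ j → removeTriangle E a b c x y ≡ false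
  separated p q i≢j = separated-Vs p q (i≢j ∘ π-injective)

reassemble : ∀ {V E a b c W} → SimpleGraphOn V E → a ~[ E ] b → a ~[ E ] c → b ~[ E ] c →
  RootedPartition V W (triple a b c) →
  (∀ {i j x y} → x ∈ W i → y ∈ W j → i ≢ j → removeTriangle E a b c x y ≡ false) →
  SameGraph E (glue a b c (λ i → restrict (removeTriangle E a b c) (W i)))
reassemble {V} {E} {a} {b} {c} {W} g a~b a~c b~c partition separated x y = ⇔→≡ {z = true} (mk⇔ into outof)
  where
  open RootedPartition partition
  open SimpleGraphOn g
  E′ = removeTriangle E a b c
  into : x ~[ E ] y → x ~[ glue a b c (λ i → restrict E′ (W i)) ] y
  into e with bool-cases (triangleEdges a b c x y)
  ... | inj₁ t = ∨-trueˡ _ t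
  ... | inj₂ t
    with i , x∈ᵢ ← cover (proj₁ (edgesInV x y e))
    with j , y∈ⱼ ← cover (proj₂ (edgesInV x y e))
    with i ≟ᶜ j
  ...   | yes refl = glue⁺ {a} {b} {c} (λ i → restrict E′ (W i)) i (restrict⁺ {E′} {W i} {x} {y} e′ x∈ᵢ y∈ⱼ)
    where e′ = removeTriangle⁺ {E} {a} {b} {c} {x} {y} e t
  ...   | no i≢j = ⊥-elim (true≢false (trans (sym e′) (separated x∈ᵢ y∈ⱼ i≢j)))
    where e′ = removeTriangle⁺ {E} {a} {b} {c} {x} {y} e t
  flip : ∀ {u v} → u ~[ E ] v → v ~[ E ] u
  flip {u} {v} e = trans (symmetric v u) e
  outof : x ~[ glue a b c (λ i → restrict E′ (W i)) ] y → x ~[ E ] y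
  outof e with glue⁻ {a} {b} {c} (λ i → restrict E′ (W i)) {x} {y} e
  ... | inj₁ ab = a~b
  ... | inj₁ ba = flip a~b
  ... | inj₁ ac = a~c
  ... | inj₁ ca = flip a~c
  ... | inj₁ bc = b~c
  ... | inj₁ cb = flip b~c
  ... | inj₂ (i , eᵢ) = proj₁ (removeTriangle⁻ {E} {a} {b} {c} {x} {y} (proj₁ (restrict⁻ {E′} {W i} {x} {y} eᵢ)))

module _ {V : List ℕ} {a b c : ℕ} {W : Corner → List ℕ} {R : List ℕ} (partition : RootedPartition V W (triple a b c))
  (sorted-S : Sorted (a ∷ b ∷ R)) (S⊆V : a ∷ b ∷ R ⊆ V) (V⊆S : V ⊆ a ∷ b ∷ R) (c∈R : c ∈ R) where

  open RootedPartition partition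

  private
    corner-of : ℕ → Corner
    corner-of z with z ∈? W c₁ | z ∈? W c₂
    ... | yes _ | _ = c₁
    ... | no _ | yes _ = c₂
    ... | no _ | no _ = c₃

    corner-of-∈ : ∀ {z} → z ∈ V → z ∈ W (corner-of z)
    corner-of-∈ {z} z∈ with z ∈? W c₁ | z ∈? W c₂ | cover z∈
    ... | yes z∈₁ | _ | _ = z∈₁
    ... | no _ | yes z∈₂ | _ = z∈₂
    ... | no z∉₁ | no _ | c₁ , z∈₁ = ⊥-elim (z∉₁ z∈₁)
    ... | no _ | no z∉₂ | c₂ , z∈₂ = ⊥-elim (z∉₂ z∈₂)
    ... | no _ | no _ | c₃ , z∈₃ = z∈₃

    R′ = proj₁ (∈-picks⁺ c∈R)
    p∈ = proj₂ (∈-picks⁺ c∈R)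
    pick = ∈-picks⁻ (AllPairs.tail (AllPairs.tail sorted-S)) p∈
    P = splitBy corner-of R′

  decomposition-of : ∃[ P ] (c , P) ∈ decompositions R × (∀ i → canonical (W i) ≡ component a b (c , P) i)
  decomposition-of = P , δ∈ , λ i →
    sorted-extensionality (canonical-sorted (W i)) (Δ.W-sorted i)
      (λ z∈ → classify i (∈-canonical⁻ (W i) z∈))
      (λ z∈ → ∈-canonical⁺ (W i) (unclassify i (Δ.∈-W⁻ i z∈)))
    where
    δ∈ = ∈-decompositions⁺ p∈ (splitBy∈splits corner-of R′)
    module Δ = Decomposed sorted-S δ∈
    not-other-root : ∀ {i j z} → z ∈ W i → z ≡ triple a b c j → z ≢ triple a b c i → ⊥
    not-other-root {i} {j} z∈ refl z≢ with refl ← disjoint (root∈ j) z∈ = z≢ refl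
    classify : ∀ i {z} → z ∈ W i → z ∈ Δ.W i
    classify i {z} z∈ with z ≟ triple a b c i
    ... | yes refl = Δ.root∈ i
    ... | no z≢rᵢ with V⊆S (W⊆V i z∈)
    ...   | here z≡a = ⊥-elim (not-other-root {j = c₁} z∈ z≡a z≢rᵢ)
    ...   | there (here z≡b) = ⊥-elim (not-other-root {j = c₂} z∈ z≡b z≢rᵢ)
    ...   | there (there z∈R) with z ≟ c
    ...     | yes z≡c = ⊥-elim (not-other-root {j = c₃} z∈ z≡c z≢rᵢ)
    ...     | no z≢c with refl ← disjoint (corner-of-∈ (W⊆V i z∈)) z∈ =
                Δ.P⊆W i (∈-splitBy⁺ corner-of (IsPick.⊆rest pick z∈R z≢c))
    unclassify : ∀ i {z} → z ≡ triple a b c i ⊎ z ∈ P i → z ∈ W i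
    unclassify i (inj₁ refl) = root∈ i
    unclassify i (inj₂ z∈P) with z∈R′ , refl ← ∈-splitBy⁻ corner-of R′ i z∈P =
      corner-of-∈ (S⊆V (there (there (IsPick.rest⊆ pick z∈R′))))

sorted-first-two : ∀ {S V v₁ v₂} → Sorted S → S ⊆ V → V ⊆ S → IsFirst V v₁ → IsSecond V v₁ v₂ →
  ∃[ R ] S ≡ v₁ ∷ v₂ ∷ R
sorted-first-two {[]} _ _ V⊆S (v₁∈ , _) _ with () ← V⊆S v₁∈
sorted-first-two {x ∷ xs} s S⊆V V⊆S (v₁∈ , v₁≤) (v₂∈ , v₂≢v₁ , v₂≤) with V⊆S v₁∈
... | there v₁∈xs = ⊥-elim (<⇒≱ (sorted-head s v₁∈xs) (v₁≤ x (S⊆V (here refl))))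
... | here refl with V⊆S v₂∈
...   | here v₂≡v₁ = ⊥-elim (v₂≢v₁ v₂≡v₁)
...   | there v₂∈xs with xs | s | v₂∈xs
...     | y ∷ ys | s′ | here refl = ys , refl
...     | y ∷ ys | s′ | there v₂∈ys =
          ⊥-elim (<⇒≱ (sorted-head (AllPairs.tail s′) v₂∈ys)
                       (v₂≤ y (S⊆V (there (here refl))) (λ { refl → head-∉-tail s′ (here refl) })))

canonical-singleton : ∀ {V v} → (∀ x → x ∈ V ⇔ x ≡ v) → canonical V ≡ v ∷ []
canonical-singleton {V} {v} V≡v = sorted-extensionality (canonical-sorted V) ([] ∷ [])
  (λ z∈ → here (Equivalence.to (V≡v _) (∈-canonical⁻ V z∈)))
  (λ { (here refl) → ∈-canonical⁺ V (Equivalence.from (V≡v v) refl) })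

singleton-noEdges : ∀ {V E v} → SimpleGraphOn V E → (∀ x → x ∈ V ⇔ x ≡ v) → SameGraph E noEdges
singleton-noEdges {E = E} {v} g V≡v x y with E x y in e
... | false = refl
... | true with SimpleGraphOn.edgesInV g x y e
...   | x∈ , y∈ with refl ← Equivalence.to (V≡v x) x∈ | refl ← Equivalence.to (V≡v y) y∈ =
        trans (sym e) (SimpleGraphOn.loopless g v)

treesOn-complete : ∀ {V E} → TreeOfTriangles V E → ∀ n → length (canonical V) ≤ n →
  Any (SameGraph E) (treesOn n (canonical V))
treesOn-complete {V} {E} (single g _ v V≡v) n len
  rewrite canonical-singleton V≡v with s≤s _ ← len = here (singleton-noEdges g V≡v)
treesOn-complete {V} {E} (triangle g conn v₁ v₂ m first second e₁₂ m∈ m≢v₁ m≢v₂ e₁ₘ e₂ₘ _ V₁ V₂ V₃ comps t₁ t₂ t₃) n len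
  with R , canonical≡ ← sorted-first-two (canonical-sorted V) (∈-canonical⁻ V) (∈-canonical⁺ V) first second =
  subst (λ S → length S ≤ n → Any (SameGraph E) (treesOn n S)) (sym canonical≡) from-top len
  where
  E′ = removeTriangle E v₁ v₂ m
  sorted-S : Sorted (v₁ ∷ v₂ ∷ R)
  sorted-S = subst Sorted canonical≡ (canonical-sorted V)
  S⊆V : v₁ ∷ v₂ ∷ R ⊆ V
  S⊆V z∈ = ∈-canonical⁻ V (subst (_ ∈_) (sym canonical≡) z∈)
  V⊆S : V ⊆ v₁ ∷ v₂ ∷ R
  V⊆S z∈ = subst (_ ∈_) canonical≡ (∈-canonical⁺ V z∈)
  m∈R : m ∈ R
  m∈R with V⊆S m∈
  ... | here m≡v₁ = ⊥-elim (m≢v₁ m≡v₁)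
  ... | there (here m≡v₂) = ⊥-elim (m≢v₂ m≡v₂)
  ... | there (there m∈R) = m∈R
  open TopTriangle g conn (proj₁ first) (proj₁ second) m∈ comps
  ih : ∀ j n → length (canonical (Vs j)) ≤ n → Any (SameGraph (restrict E′ (Vs j))) (treesOn n (canonical (Vs j)))
  ih c₁ = treesOn-complete t₁
  ih c₂ = treesOn-complete t₂
  ih c₃ = treesOn-complete t₃
  from-top : length (v₁ ∷ v₂ ∷ R) ≤ n → Any (SameGraph E) (treesOn n (v₁ ∷ v₂ ∷ R))
  from-top (s≤s {n = n′} len′) with P , δ∈ , canonical-W ← decomposition-of partition sorted-S S⊆V V⊆S m∈R =
    lose (∈-concatMap⁺′ (λ δ → map (glue v₁ v₂ (proj₁ δ)) (choices (treesOn n′ ∘ component v₁ v₂ δ))) δ∈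
           (∈-map⁺ (glue v₁ v₂ m) (∈-choices⁺ (λ i → proj₁ (proj₂ (found i))))))
         (λ x y → trans (reassemble g e₁₂ e₁ₘ e₂ₘ partition separated x y) (glue-≈ (λ i → proj₂ (proj₂ (found i))) x y))
    where
    found : ∀ i → ∃[ e ] e ∈ treesOn n′ (component v₁ v₂ (m , P) i) × SameGraph (restrict E′ (W i)) e
    found i = find (subst (λ S → Any (SameGraph (restrict E′ (W i))) (treesOn n′ S)) (canonical-W i)
                (ih (π i) n′ (subst (_≤ n′) (sym (cong length (canonical-W i)))
                  (≤-trans (Decomposed.W-shorter sorted-S δ∈ i) (<⇒≤ len′)))))

proposition2p3 : (k : ℕ) → 1 ≤ k → (V : List ℕ) → Unique V → length V ≡ 2 * k ∸ 1 →
    NumberOfTreesOfTriangles V (df (2 * k ∸ 3) ^ 2) ×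
    (∀ E → TreeOfTriangles V E → FactorCritical V E × HasEdgeCount V E (3 * k ∸ 3))
proposition2p3 (suc j) (s≤s z≤n) V unique-V length-V =
  (treesOn N S , count , All.map (λ c → tree-resp-⊆ (CertifiedTree.tree c) S⊆V V⊆S) certified ,
   treesOn-distinct N sorted ≤-refl , λ E t → treesOn-complete t N ≤-refl) ,
  λ E t → let G , G∈ , E≈G = find (treesOn-complete t N ≤-refl) ; c = All.lookup certified G∈ in
    factorCritical-transport (CertifiedTree.factorCritical c) S⊆V V⊆S E≈G ,
    edgeCount-transport (subst (HasEdgeCount S G) (edges≡ c) (CertifiedTree.edgeCount c)) S⊆V V⊆S E≈G
  where
  S = canonical V
  N = length S
  sorted = canonical-sorted V
  S⊆V = ∈-canonical⁻ V
  V⊆S = ∈-canonical⁺ V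
  length-S : length S ≡ suc (2 * j)
  length-S = trans (length-canonical V unique-V) (trans length-V (cong (_∸ 1) (*-suc 2 j)))
  certified : All (CertifiedTree S) (treesOn N S)
  certified = treesOn-certified N sorted ≤-refl
  count : length (treesOn N S) ≡ df (2 * suc j ∸ 3) ^ 2
  count = trans (length-treesOn N sorted ≤-refl length-S)
                (trans (τ-even j) (cong (λ n → df (n ∸ 3) ^ 2) (sym (*-suc 2 j))))
  half≡j : ∀ {G} (c : CertifiedTree S G) → CertifiedTree.half c ≡ j
  half≡j c = *-cancelˡ-≡ (CertifiedTree.half c) j 2 (suc-injective (trans (sym (CertifiedTree.size c)) length-S))
  edges≡ : ∀ {G} (c : CertifiedTree S G) → 3 * CertifiedTree.half c ≡ 3 * suc j ∸ 3
  edges≡ c = trans (cong (3 *_) (half≡j c)) (cong (_∸ 3) (sym (*-suc 3 j)))
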